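{- Let $A$ be a regular system of divisors and let $n=p_1^{a_1}\cdots p_r^{a_r}$ with $r\ge1$ and distinct primes $p_i$, such that each $p_i^{a_i}$ is $A$-primitive. Write $\Phi_{A,n}(x)=\sum_{j=0}^{\varphi_A(n)}a_{A,n}(j)x^j$. Then $a_{A,n}(0)=1$ and for every $k$ with $1\le k\le\varphi_A(n)$, \[ a_{A,n}(k)=-\frac{\mu_A(n)}{k}\sum_{j=1}^k a_{A,n}(k-j)\,\mu_A\big((j,n)_A\big)\,\varphi_A\big((j,n)_A\big). \]
   Context: A regular system of divisors is a family $A=(A(n))_{n\in\mathbb N}$, where each $A(n)$ is a set of positive divisors of $n$, such that: (i) $A(1)=\{1\}$ and $A(mn)=\{de: d\in A(m), e\in A(n)\}$ whenever $\gcd(m,n)=1$; (ii) for every prime power $p^a$ ($a\ge1$) there is a divisor $t=t_A(p^a)$ of $a$ such that $A(p^{it})=\{1,p^t,\dots,p^{it}\}$ for every $0\le i\le a/t$. An integer $m>1$ is $A$-primitive if $A(m)=\{1,m\}$. $\mu_A$ is the inverse of the constant function $1$ under the $A$-convolution $(f*_Ag)(n)=\sum_{d\in A(n)}f(d)g(n/d)$ (multiplicative, with $\mu_A(p^a)=-1$ if $p^a$ is $A$-primitive and $0$ otherwise, $a\ge1$). For $j\in\mathbb Z$, $(j,n)_A=\max\{d\in\mathbb N: d\mid j,\ d\in A(n)\}$; $\zeta_n=e^{2\pi i/n}$; $\Phi_{A,n}(x)=\prod_{1\le j\le n,\ (j,n)_A=1}(x-\zeta_n^j)$; $\varphi_A(n)=\#\{1\le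 j\le n:(j,n)_A=1\}$. -}

module Defs where

open import Level using (Level; _⊔_)
open import Data.Nat as ℕ using (ℕ; zero; suc; _≤_; _<_; _^_)
open import Data.Nat.Divisibility using (_∣_; _∣?_)
open import Data.Nat.Coprimality using (Coprime)
open import Data.Nat.Primality using (Prime)
open import Data.Integer as ℤ using (ℤ; +_; -[1+_])
open import Data.List using (List; []; _∷_; map; filter; foldr; applyUpTo; length; lookup)
open import Data.Nat.ListAction using (product)
open import Data.List.Relation.Unary.All using (All)
open import Data.List.Relation.Unary.AllPairs using (AllPairs)
open import Data.Product using (Σ; ∃; ∃-syntax; _×_; _,_; proj₁; proj₂)
open import Function.Bundles using (_⇔_)
open import Relation.Binary.PropositionalEquality using (_≡_; _≢_)
open import Relation.Nullary using (Dec; ¬_)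
open import Relation.Nullary.Decidable using (_×-dec_)
open import Algebra.Bundles using (CommutativeRing)

-- Regular systems of divisors.
-- A(n) is given by a (decidable) membership predicate  d ∈A n.
-- Only the values at n ≥ 1 matter; A(0) is unconstrained.

record RegularSystem : Set₁ where
  field
    _∈A_  : ℕ → ℕ → Set
    _∈A?_ : ∀ d n → Dec (d ∈A n)
    divisor : ∀ {d n} → 1 ≤ n → d ∈A n → d ∣ n
    at-one : ∀ d → (d ∈A 1) ⇔ (d ≡ 1)
    multiplicative : ∀ m n → 1 ≤ m → 1 ≤ n → Coprime m n → ∀ d →
      (d ∈A (m ℕ.* n)) ⇔ (∃[ e ] ∃[ f ] (e ∈A m × f ∈A n × d ≡ e ℕ.* f))
    prime-power : ∀ p a → Prime p → 1 ≤ a →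
      ∃[ t ] (t ∣ a × (∀ i → i ℕ.* t ≤ a → ∀ d →
        (d ∈A (p ^ (i ℕ.* t))) ⇔ (∃[ s ] (s ≤ i × d ≡ p ^ (s ℕ.* t)))))

module _ (A : RegularSystem) where
  open RegularSystem A

  range1 : ℕ → List ℕ
  range1 n = applyUpTo suc n

  Adivisors : ℕ → List ℕ
  Adivisors n = filter (λ d → d ∈A? n) (range1 n)

  APrimitive : ℕ → Set
  APrimitive m = 1 < m × (∀ d → (d ∈A m) ⇔ (d ≡ 1 Data.Sum.⊎ d ≡ m))
    where import Data.Sum

  -- (j, n)_A = max { d : d ∣ j, d ∈ A(n) }   (for n ≥ 1, all such d are ≤ n)
  gcdA : ℕ → ℕ → ℕ
  gcdA j n = foldr ℕ._⊔_ 0 (filter (λ d → (d ∣? j) ×-dec (d ∈A? n)) (range1 n))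

  unitsA : ℕ → List ℕ
  unitsA n = filter (λ j → gcdA j n ℕ.≟ 1) (range1 n)

  φA : ℕ → ℕ
  φA n = length (unitsA n)

  -- μ is the inverse of the constant function 1 under A-convolution:
  -- (μ *_A 1)(n) = Σ_{d ∈ A(n)} μ(d) = [n = 1] for all n ≥ 1.
  IsMuA : (ℕ → ℤ) → Set
  IsMuA μ = ∀ n → 1 ≤ n →
    foldr ℤ._+_ (+ 0) (map μ (Adivisors n)) ≡ (if n ℕ.≡ᵇ 1 then + 1 else + 0)
    where open import Data.Bool using (if_then_else_)

  PrimitiveFactorisation : ℕ → List (ℕ × ℕ) → Set
  PrimitiveFactorisation n ps =
    1 ≤ length ps ×
    All (λ pa → Prime (proj₁ pa)) ps ×
    AllPairs (λ pa qb → proj₁ pa ≢ proj₁ qb) ps ×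
    All (λ pa → APrimitive (proj₁ pa ^ proj₂ pa)) ps ×
    n ≡ product (map (λ pa → proj₁ pa ^ proj₂ pa) ps)

-- Polynomials over a commutative ring as coefficient lists
-- (lowest degree first), and the ambient "complex" setting.

module Poly {c ℓ : Level} (R : CommutativeRing c ℓ) where
  open CommutativeRing R

  Pol : Set c
  Pol = List Carrier

  _+P_ : Pol → Pol → Pol
  [] +P q = q
  (a ∷ p) +P [] = a ∷ p
  (a ∷ p) +P (b ∷ q) = (a + b) ∷ (p +P q)

  mulLin : Carrier → Pol → Pol
  mulLin z p = (0# ∷ p) +P map (λ a → - (z * a)) p

  prodLin : List Carrier → Pol
  prodLin zs = foldr mulLin (1# ∷ []) zs

  coeff : Pol → ℕ → Carrier
  coeff [] k = 0#
  coeff (a ∷ p) zero = a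
  coeff (a ∷ p) (suc k) = coeff p k

  pow : Carrier → ℕ → Carrier
  pow x zero = 1#
  pow x (suc k) = x * pow x k

  ιℕ : ℕ → Carrier
  ιℕ zero = 0#
  ιℕ (suc k) = 1# + ιℕ k

  ιℤ : ℤ → Carrier
  ιℤ (+ k) = ιℕ k
  ιℤ -[1+ k ] = - ιℕ (suc k)

  sumR : List Carrier → Carrier
  sumR = foldr _+_ 0#

  IntegralDomainChar0 : Set (c ⊔ ℓ)
  IntegralDomainChar0 =
    ¬ (1# ≈ 0#) ×
    (∀ x y → x * y ≈ 0# → x ≈ 0# Data.Sum.⊎ y ≈ 0#) ×
    (∀ k → ¬ (ιℕ (suc k) ≈ 0#))
    where import Data.Sum

  PrimitiveRoot : ℕ → Carrier → Set ℓ
  PrimitiveRoot n ζ = pow ζ n ≈ 1# × (∀ k → 1 ≤ k → k < n → ¬ (pow ζ k ≈ 1#))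

module _ (A : RegularSystem) {c ℓ : Level} (R : CommutativeRing c ℓ) where
  open Poly R

  PhiA : CommutativeRing.Carrier R → ℕ → Pol
  PhiA ζ n = prodLin (map (pow ζ) (unitsA A n))

  coeffA : CommutativeRing.Carrier R → ℕ → ℕ → CommutativeRing.Carrier R
  coeffA ζ n k = coeff (PhiA ζ n) k

-- As each q = p^a is A-primitive, A(n) consists of the products of sublists of the q's, so (j, n)_A
-- is the product of the q's dividing j and the A-units are the u ≤ n divisible by no q.
-- Newton's identities for Φ_{A,n} = ∏_u (x - ζ^u) express k·a(k) through the power sums ∑_u ζ^{-u j};
-- inclusion–exclusion over the q's evaluates these sums as ∏_q (q·[q ∣ j] - 1), which equals
-- μ_A(n) μ_A(g) φ_A(g) for g = (j, n)_A, since μ_A(∏ T) = (-1)^|T| and φ_A(∏ T) = ∏_{q ∈ T} (q - 1).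
-- For the constant term, a(0) = (-1)^φ ζ^{∑ u}; inclusion–exclusion also gives 2 ∑ u = n φ, so if φ
-- is odd then n is even and ζ^{∑ u} = (ζ^{n/2})^φ = (-1)^φ, whence a(0) = 1.
module Submission where

open import Level using (Level)
open import Function.Base using (_∘_)
open import Function.Bundles using (_⇔_; mk⇔; Equivalence)
open import Data.Bool.Base using (Bool; true; false; not; _∧_; if_then_else_)
open import Data.Empty using (⊥-elim)
open import Data.Maybe.Base using (Maybe; just; nothing)
open import Data.Product.Base using (∃-syntax; _×_; _,_; proj₁; proj₂)
open import Data.Sum.Base using (_⊎_; inj₁; inj₂)
open import Data.Nat.Base as ℕ using (ℕ; zero; suc; _≤_; _<_; _∸_; _^_)
import Data.Nat.Properties as ℕ
open import Data.Nat.Divisibility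
  using ( _∣_; _∣?_; divides; ∣-refl; ∣-trans; ∣⇒≤; ∣1⇒≡1; 1∣_; ∣m∣n⇒∣m+n; ∣m+n∣m⇒∣n
        ; ∣n⇒∣m*n; m∣m*n; m*n∣⇒m∣; m*n∣⇒n∣; *-monoʳ-∣; *-cancelˡ-∣; m%n≡0⇒n∣m)
open import Data.Nat.DivMod using (_%_; _/_; m≡m%n+[m/n]*n; m%n<n; m*n/n≡m)
open import Data.Nat.Coprimality as Coprime using (Coprime; coprime-divisor)
open import Data.Nat.Primality using (Prime; prime⇒irreducible; prime⇒nonTrivial)
open import Data.Nat.ListAction using (sum; product)
open import Data.Nat.ListAction.Properties using (∈⇒∣product)
open import Data.Nat.Induction using (<-rec)
open import Data.Nat.Tactic.RingSolver using (solve-∀)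
open import Data.Integer.Base as ℤ using (ℤ; +_; -[1+_])
import Data.Integer.Properties as ℤ
open import Data.Sign.Base as Sign using (Sign)
open import Data.List.Base using (List; []; _∷_; map; filter; applyUpTo; length; foldr)
open import Data.List.Properties using (filter-all)
open import Data.List.Membership.Propositional using (_∈_)
open import Data.List.Membership.Propositional.Properties using (∈-filter⁺; ∈-filter⁻; ∈-applyUpTo⁺)
open import Data.List.Relation.Unary.Any using (here; there)
open import Data.List.Relation.Unary.All as All using (All; []; _∷_)
open import Data.List.Relation.Unary.All.Properties using (all-filter; map⁺)
open import Data.List.Relation.Unary.AllPairs using (AllPairs; []; _∷_)
open import Data.List.Relation.Binary.Sublist.Propositional using (_⊆_; []; _∷_; _∷ʳ_; ⊆-refl)
open import Data.List.Relation.Binary.Sublist.Propositional.Properties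
  using (All-resp-⊆; filter-⊆; filter⁺; length-mono-≤)
open import Relation.Nullary using (¬_; Dec; yes; no; does)
open import Relation.Nullary.Decidable using (dec-true; dec-false; does-⇔; _×-dec_)
open import Relation.Binary.PropositionalEquality as ≡ using (_≡_; _≢_)
open import Algebra.Bundles using (CommutativeRing)
open import Algebra.Solver.Ring.AlmostCommutativeRing using (_-Raw-AlmostCommutative⟶_; fromCommutativeRing)
import Algebra.Solver.Ring
open import Defs

prime>1 : ∀ {p} → Prime p → 1 < p
prime>1 {p} p-prime = ℕ.nonTrivial⇒n>1 p {{prime⇒nonTrivial p-prime}}

coprime-1 : ∀ m → Coprime m 1
coprime-1 m (_ , d∣1) = ∣1⇒≡1 d∣1

coprime-*ʳ : ∀ {m n o} → Coprime m n → Coprime m o → Coprime m (n ℕ.* o)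
coprime-*ʳ {m} {n} m⊥n m⊥o {d} (d∣m , d∣no) = m⊥o (d∣m , coprime-divisor d⊥n d∣no)
  where
  d⊥n : Coprime d n
  d⊥n (e∣d , e∣n) = m⊥n (∣-trans e∣d d∣m , e∣n)

coprime-^ʳ : ∀ {m n} → Coprime m n → ∀ k → Coprime m (n ^ k)
coprime-^ʳ {m} m⊥n zero = coprime-1 m
coprime-^ʳ m⊥n (suc k) = coprime-*ʳ m⊥n (coprime-^ʳ m⊥n k)

coprime-^ : ∀ {m n} → Coprime m n → ∀ j k → Coprime (m ^ j) (n ^ k)
coprime-^ m⊥n j k = Coprime.sym (coprime-^ʳ (Coprime.sym (coprime-^ʳ m⊥n k)) j)

distinct-primes-coprime : ∀ {p q} → Prime p → Prime q → p ≢ q → Coprime p q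
distinct-primes-coprime p-prime q-prime p≢q (d∣p , d∣q)
  with prime⇒irreducible p-prime d∣p | prime⇒irreducible q-prime d∣q
... | inj₁ d≡1 | _ = d≡1
... | inj₂ ≡.refl | inj₁ p≡1 = ⊥-elim (ℕ.<⇒≢ (prime>1 p-prime) (≡.sym p≡1))
... | inj₂ ≡.refl | inj₂ ≡.refl = ⊥-elim (p≢q ≡.refl)

prime-powers-coprime : ∀ {ps : List (ℕ × ℕ)} →
  All (Prime ∘ proj₁) ps → AllPairs (λ x y → proj₁ x ≢ proj₁ y) ps →
  AllPairs Coprime (map (λ pa → proj₁ pa ^ proj₂ pa) ps)
prime-powers-coprime [] [] = []
prime-powers-coprime {(p , a) ∷ ps} (p-prime ∷ ps-prime) (p≢ps ∷ ps-distinct) =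
  coprime-to-all ps-prime p≢ps ∷ prime-powers-coprime ps-prime ps-distinct
  where
  coprime-to-all : ∀ {ps : List (ℕ × ℕ)} → All (Prime ∘ proj₁) ps → All (λ y → p ≢ proj₁ y) ps →
    All (Coprime (p ^ a)) (map (λ pa → proj₁ pa ^ proj₂ pa) ps)
  coprime-to-all [] [] = []
  coprime-to-all {(p′ , b) ∷ _} (p′-prime ∷ ps-prime) (p≢p′ ∷ p≢ps) =
    coprime-^ (distinct-primes-coprime p-prime p′-prime p≢p′) a b ∷ coprime-to-all ps-prime p≢ps

coprime-*-∣ : ∀ {m n o} → Coprime m n → m ∣ o → n ∣ o → m ℕ.* n ∣ o
coprime-*-∣ {m} {n} m⊥n (divides k ≡.refl) n∣km =
  ≡.subst (m ℕ.* n ∣_) (ℕ.*-comm m k)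
    (*-monoʳ-∣ m (coprime-divisor (Coprime.sym m⊥n) (≡.subst (n ∣_) (ℕ.*-comm k m) n∣km)))

coprime-product : ∀ {m ns} → All (Coprime m) ns → Coprime m (product ns)
coprime-product {m} [] = coprime-1 m
coprime-product (m⊥n ∷ m⊥ns) = coprime-*ʳ m⊥n (coprime-product m⊥ns)

product-∣ : ∀ {ns o} → AllPairs Coprime ns → All (_∣ o) ns → product ns ∣ o
product-∣ {o = o} [] [] = 1∣ o
product-∣ (n⊥ns ∷ ns-coprime) (n∣o ∷ ns∣o) =
  coprime-*-∣ (coprime-product n⊥ns) n∣o (product-∣ ns-coprime ns∣o)

product-positive : ∀ {ns} → All (1 ≤_) ns → 1 ≤ product ns
product-positive [] = ℕ.s≤s ℕ.z≤n
product-positive (1≤n ∷ 1≤ns) = ℕ.*-mono-≤ 1≤n (product-positive 1≤ns)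

avoids : List ℕ → ℕ → Bool
avoids [] u = true
avoids (q ∷ qs) u = not (does (q ∣? u)) ∧ avoids qs u

-1^_ : ℕ → ℤ
-1^ zero = + 1
-1^ suc k = ℤ.- (-1^ k)

even-or-odd : ∀ k → ∃[ h ] (k ≡ 2 ℕ.* h ⊎ k ≡ suc (2 ℕ.* h))
even-or-odd zero = 0 , inj₁ ≡.refl
even-or-odd (suc k) with even-or-odd k
... | h , inj₁ ≡.refl = h , inj₂ ≡.refl
... | h , inj₂ ≡.refl = suc h , inj₁ (≡.sym (ℕ.*-suc 2 h))

AllPairs-resp-⊆ : ∀ {R : ℕ → ℕ → Set} {xs ys} → xs ⊆ ys → AllPairs R ys → AllPairs R xs
AllPairs-resp-⊆ [] [] = []
AllPairs-resp-⊆ (y ∷ʳ xs⊆ys) (_ ∷ Rys) = AllPairs-resp-⊆ xs⊆ys Rys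
AllPairs-resp-⊆ (≡.refl ∷ xs⊆ys) (Ry ∷ Rys) = All-resp-⊆ xs⊆ys Ry ∷ AllPairs-resp-⊆ xs⊆ys Rys

⊆⇒product-∣ : ∀ {xs ys} → xs ⊆ ys → product xs ∣ product ys
⊆⇒product-∣ [] = ∣-refl
⊆⇒product-∣ (y ∷ʳ xs⊆ys) = ∣n⇒∣m*n y (⊆⇒product-∣ xs⊆ys)
⊆⇒product-∣ (_∷_ {x = x} ≡.refl xs⊆ys) = *-monoʳ-∣ x (⊆⇒product-∣ xs⊆ys)

foldr-⊔-≡ : ∀ {g} ys → All (_≤ g) ys → g ∈ ys → foldr ℕ._⊔_ 0 ys ≡ g
foldr-⊔-≡ (y ∷ ys) (_ ∷ ys≤g) (here ≡.refl) = ℕ.m≥n⇒m⊔n≡m (foldr-⊔-≤ ys ys≤g)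
  where
  foldr-⊔-≤ : ∀ {g} ys → All (_≤ g) ys → foldr ℕ._⊔_ 0 ys ≤ g
  foldr-⊔-≤ [] [] = ℕ.z≤n
  foldr-⊔-≤ (y ∷ ys) (y≤g ∷ ys≤g) = ℕ.⊔-lub y≤g (foldr-⊔-≤ ys ys≤g)
foldr-⊔-≡ (y ∷ ys) (y≤g ∷ ys≤g) (there g∈ys) =
  ≡.trans (≡.cong (y ℕ.⊔_) (foldr-⊔-≡ ys ys≤g g∈ys)) (ℕ.m≤n⇒m⊔n≡n y≤g)

module Ring {c ℓ : Level} (R : CommutativeRing c ℓ) where
  open CommutativeRing R
  open Poly R
  open import Algebra.Properties.Ring ring public
  open import Relation.Binary.Reasoning.Setoid setoid public
  open import Algebra.Properties.CommutativeSemigroup +-commutativeSemigroup public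
    using () renaming (interchange to +-interchange)
  open import Algebra.Properties.CommutativeSemigroup *-commutativeSemigroup public
    using () renaming (interchange to *-interchange)

  ιℕ-+ : ∀ m n → ιℕ (m ℕ.+ n) ≈ ιℕ m + ιℕ n
  ιℕ-+ zero n = sym (+-identityˡ _)
  ιℕ-+ (suc m) n = trans (+-congˡ (ιℕ-+ m n)) (sym (+-assoc _ _ _))

  ιℕ-* : ∀ m n → ιℕ (m ℕ.* n) ≈ ιℕ m * ιℕ n
  ιℕ-* zero n = sym (zeroˡ _)
  ιℕ-* (suc m) n = begin
    ιℕ (n ℕ.+ m ℕ.* n)       ≈⟨ ιℕ-+ n (m ℕ.* n) ⟩
    ιℕ n + ιℕ (m ℕ.* n)      ≈⟨ +-cong (sym (*-identityˡ _)) (ιℕ-* m n) ⟩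
    1# * ιℕ n + ιℕ m * ιℕ n  ≈⟨ sym (distribʳ _ _ _) ⟩
    (1# + ιℕ m) * ιℕ n       ∎

  ιℕ-1 : ιℕ 1 ≈ 1#
  ιℕ-1 = +-identityʳ 1#

  1+-cancel-− : ∀ x y → (1# + x) - (1# + y) ≈ x - y
  1+-cancel-− x y = begin
    (1# + x) - (1# + y)      ≈⟨ +-congˡ (sym (-‿+-comm 1# y)) ⟩
    (1# + x) + (- 1# + - y)  ≈⟨ +-assoc _ _ _ ⟩
    1# + (x + (- 1# + - y))  ≈⟨ +-congˡ (sym (+-assoc _ _ _)) ⟩
    1# + ((x + - 1#) + - y)  ≈⟨ +-congˡ (+-congʳ (+-comm _ _)) ⟩
    1# + ((- 1# + x) + - y)  ≈⟨ +-congˡ (+-assoc _ _ _) ⟩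
    1# + (- 1# + (x - y))    ≈⟨ sym (+-assoc _ _ _) ⟩
    (1# - 1#) + (x - y)      ≈⟨ +-congʳ (-‿inverseʳ 1#) ⟩
    0# + (x - y)             ≈⟨ +-identityˡ _ ⟩
    x - y                    ∎

  ιℤ-⊖ : ∀ m n → ιℤ (m ℤ.⊖ n) ≈ ιℕ m - ιℕ n
  ιℤ-⊖ m zero rewrite ℤ.⊖-≥ {m} {0} ℕ.z≤n =
    trans (sym (+-identityʳ _)) (+-congˡ (sym -0#≈0#))
  ιℤ-⊖ zero (suc n) rewrite ℤ.⊖-< {0} {suc n} (ℕ.s≤s ℕ.z≤n) = sym (+-identityˡ _)
  ιℤ-⊖ (suc m) (suc n) rewrite ℤ.[1+m]⊖[1+n]≡m⊖n m n =
    trans (ιℤ-⊖ m n) (sym (1+-cancel-− _ _))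

  ιℤ-+ : ∀ i j → ιℤ (i ℤ.+ j) ≈ ιℤ i + ιℤ j
  ιℤ-+ (+ m) (+ n) = ιℕ-+ m n
  ιℤ-+ (+ m) -[1+ n ] = ιℤ-⊖ m (suc n)
  ιℤ-+ -[1+ m ] (+ n) = trans (ιℤ-⊖ n (suc m)) (+-comm _ _)
  ιℤ-+ -[1+ m ] -[1+ n ] = begin
    - ιℕ (suc (suc (m ℕ.+ n)))  ≡⟨ ≡.cong (-_ ∘ ιℕ) (≡.sym (ℕ.+-suc (suc m) n)) ⟩
    - ιℕ (suc m ℕ.+ suc n)      ≈⟨ -‿cong (ιℕ-+ (suc m) (suc n)) ⟩
    - (ιℕ (suc m) + ιℕ (suc n)) ≈⟨ sym (-‿+-comm _ _) ⟩
    - ιℕ (suc m) + - ιℕ (suc n) ∎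

  ιℤ-neg : ∀ i → ιℤ (ℤ.- i) ≈ - ιℤ i
  ιℤ-neg (+ zero) = sym -0#≈0#
  ιℤ-neg (+ suc n) = refl
  ιℤ-neg -[1+ n ] = sym (-‿involutive _)

  ιSign : Sign → Carrier
  ιSign Sign.+ = 1#
  ιSign Sign.- = - 1#

  ιSign-* : ∀ s t → ιSign (s Sign.* t) ≈ ιSign s * ιSign t
  ιSign-* Sign.+ t = sym (*-identityˡ _)
  ιSign-* Sign.- Sign.+ = sym (*-identityʳ _)
  ιSign-* Sign.- Sign.- = begin
    1#             ≈⟨ sym (-‿involutive _) ⟩
    - - 1#         ≈⟨ -‿cong (sym (-1*x≈-x _)) ⟩
    - (- 1# * 1#)  ≈⟨ -‿distribʳ-* _ _ ⟩
    - 1# * - 1#    ∎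

  ιℤ-◃ : ∀ s k → ιℤ (s ℤ.◃ k) ≈ ιSign s * ιℕ k
  ιℤ-◃ s zero = sym (zeroʳ _)
  ιℤ-◃ Sign.+ (suc k) = sym (*-identityˡ _)
  ιℤ-◃ Sign.- (suc k) = sym (-1*x≈-x _)

  ιℤ≈sign*abs : ∀ i → ιℤ i ≈ ιSign (ℤ.sign i) * ιℕ ℤ.∣ i ∣
  ιℤ≈sign*abs (+ n) = sym (*-identityˡ _)
  ιℤ≈sign*abs -[1+ n ] = sym (-1*x≈-x _)

  ιℤ-* : ∀ i j → ιℤ (i ℤ.* j) ≈ ιℤ i * ιℤ j
  ιℤ-* i j = begin
    ιℤ (s ℤ.◃ ℤ.∣ i ∣ ℕ.* ℤ.∣ j ∣)           ≈⟨ ιℤ-◃ s (ℤ.∣ i ∣ ℕ.* ℤ.∣ j ∣) ⟩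
    ιSign s * ιℕ (ℤ.∣ i ∣ ℕ.* ℤ.∣ j ∣)
                                            ≈⟨ *-cong (ιSign-* (ℤ.sign i) (ℤ.sign j)) (ιℕ-* ℤ.∣ i ∣ ℤ.∣ j ∣) ⟩
    (ιSign (ℤ.sign i) * ιSign (ℤ.sign j)) * (ιℕ ℤ.∣ i ∣ * ιℕ ℤ.∣ j ∣)
                                            ≈⟨ *-interchange _ _ _ _ ⟩
    (ιSign (ℤ.sign i) * ιℕ ℤ.∣ i ∣) * (ιSign (ℤ.sign j) * ιℕ ℤ.∣ j ∣)
                                            ≈⟨ sym (*-cong (ιℤ≈sign*abs i) (ιℤ≈sign*abs j)) ⟩
    ιℤ i * ιℤ j                             ∎
    where s = ℤ.sign i Sign.* ℤ.sign j

  -- ιℤ with ιℤ (+ 1) = 1# on the nose, so that the solver's constant 1 denotes 1#.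
  ιℤ′ : ℤ → Carrier
  ιℤ′ (+ 1) = 1#
  ιℤ′ i     = ιℤ i

  ιℤ′≈ιℤ : ∀ i → ιℤ′ i ≈ ιℤ i
  ιℤ′≈ιℤ (+ 1) = sym ιℕ-1
  ιℤ′≈ιℤ (+ zero) = refl
  ιℤ′≈ιℤ (+ suc (suc n)) = refl
  ιℤ′≈ιℤ -[1+ n ] = refl

  ιℤ′-homomorphism : CommutativeRing.rawRing ℤ.+-*-commutativeRing
    -Raw-AlmostCommutative⟶ fromCommutativeRing R
  ιℤ′-homomorphism = record
    { ⟦_⟧    = ιℤ′
    ; +-homo = λ i j → via (i ℤ.+ j) (ιℤ-+ i j) (+-cong (ιℤ′≈ιℤ i) (ιℤ′≈ιℤ j))
    ; *-homo = λ i j → via (i ℤ.* j) (ιℤ-* i j) (*-cong (ιℤ′≈ιℤ i) (ιℤ′≈ιℤ j))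
    ; -‿homo = λ i → via (ℤ.- i) (ιℤ-neg i) (-‿cong (ιℤ′≈ιℤ i))
    ; 0-homo = refl
    ; 1-homo = refl
    }
    where
    via : ∀ i {x y} → ιℤ i ≈ x → y ≈ x → ιℤ′ i ≈ y
    via i p q = trans (ιℤ′≈ιℤ i) (trans p (sym q))

  ιℤ′-≟ : ∀ i j → Maybe (ιℤ′ i ≈ ιℤ′ j)
  ιℤ′-≟ i j with i ℤ.≟ j
  ... | yes ≡.refl = just refl
  ... | no _ = nothing

  module Solver = Algebra.Solver.Ring _ _ ιℤ′-homomorphism ιℤ′-≟
  open Solver public using (solve; _:=_; _:+_; _:*_; _:-_; :-_; con)

  pow-+ : ∀ x m n → pow x (m ℕ.+ n) ≈ pow x m * pow x n
  pow-+ x zero n = sym (*-identityˡ _)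
  pow-+ x (suc m) n = trans (*-congˡ (pow-+ x m n)) (sym (*-assoc _ _ _))

  pow-* : ∀ x m n → pow x (m ℕ.* n) ≈ pow (pow x m) n
  pow-* x m zero rewrite ℕ.*-zeroʳ m = refl
  pow-* x m (suc n) = begin
    pow x (m ℕ.* suc n)           ≡⟨ ≡.cong (pow x) (ℕ.*-suc m n) ⟩
    pow x (m ℕ.+ m ℕ.* n)         ≈⟨ pow-+ x m (m ℕ.* n) ⟩
    pow x m * pow x (m ℕ.* n)     ≈⟨ *-congˡ (pow-* x m n) ⟩
    pow x m * pow (pow x m) n     ∎

  pow-cong : ∀ {x y} → x ≈ y → ∀ n → pow x n ≈ pow y n
  pow-cong x≈y zero = refl
  pow-cong x≈y (suc n) = *-cong x≈y (pow-cong x≈y n)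

  pow-1# : ∀ n → pow 1# n ≈ 1#
  pow-1# zero = refl
  pow-1# (suc n) = trans (*-identityˡ _) (pow-1# n)

  pow-root-of-unity : ∀ {x} m → pow x m ≈ 1# → ∀ n → pow x (m ℕ.* n) ≈ 1#
  pow-root-of-unity {x} m xᵐ≈1 n = trans (pow-* x m n) (trans (pow-cong xᵐ≈1 n) (pow-1# n))

  when : Bool → Carrier → Carrier
  when b x = if b then x else 0#

  when-cong : ∀ b {x y} → x ≈ y → when b x ≈ when b y
  when-cong true x≈y = x≈y
  when-cong false x≈y = refl

  when-≡ : ∀ {b b′} x → b ≡ b′ → when b x ≈ when b′ x
  when-≡ x ≡.refl = refl

  [_∣_] : ℕ → ℕ → Carrier
  [ d ∣ m ] = when (does (d ∣? m)) 1#

  -- ∑ n f = f 0 + ⋯ + f (n - 1) and ∑₁ n f = f 1 + ⋯ + f n.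
  ∑ : ℕ → (ℕ → Carrier) → Carrier
  ∑ zero f = 0#
  ∑ (suc n) f = f 0 + ∑ n (f ∘ suc)

  ∑₁ : ℕ → (ℕ → Carrier) → Carrier
  ∑₁ n f = ∑ n (f ∘ suc)

  ∑-cong< : ∀ n {f g : ℕ → Carrier} → (∀ i → i ℕ.< n → f i ≈ g i) → ∑ n f ≈ ∑ n g
  ∑-cong< zero f≈g = refl
  ∑-cong< (suc n) f≈g = +-cong (f≈g 0 (ℕ.s≤s ℕ.z≤n)) (∑-cong< n (λ i i<n → f≈g (suc i) (ℕ.s≤s i<n)))

  ∑-cong : ∀ n {f g : ℕ → Carrier} → (∀ i → f i ≈ g i) → ∑ n f ≈ ∑ n g
  ∑-cong n f≈g = ∑-cong< n (λ i _ → f≈g i)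

  ∑-zero : ∀ n {f : ℕ → Carrier} → (∀ i → i ℕ.< n → f i ≈ 0#) → ∑ n f ≈ 0#
  ∑-zero n f≈0 = trans (∑-cong< n f≈0) (∑-0# n)
    where
    ∑-0# : ∀ n → ∑ n (λ _ → 0#) ≈ 0#
    ∑-0# zero = refl
    ∑-0# (suc n) = trans (+-identityˡ _) (∑-0# n)

  ∑-+ : ∀ n (f g : ℕ → Carrier) → ∑ n (λ i → f i + g i) ≈ ∑ n f + ∑ n g
  ∑-+ zero f g = sym (+-identityˡ _)
  ∑-+ (suc n) f g = trans (+-congˡ (∑-+ n _ _)) (+-interchange _ _ _ _)

  ∑-*ˡ : ∀ n x (f : ℕ → Carrier) → ∑ n (λ i → x * f i) ≈ x * ∑ n f
  ∑-*ˡ zero x f = sym (zeroʳ _)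
  ∑-*ˡ (suc n) x f = trans (+-congˡ (∑-*ˡ n x _)) (sym (distribˡ _ _ _))

  ∑-neg : ∀ n (f : ℕ → Carrier) → ∑ n (λ i → - f i) ≈ - ∑ n f
  ∑-neg zero f = sym -0#≈0#
  ∑-neg (suc n) f = trans (+-congˡ (∑-neg n _)) (-‿+-comm _ _)

  ∑-− : ∀ n (f g : ℕ → Carrier) → ∑ n (λ i → f i - g i) ≈ ∑ n f - ∑ n g
  ∑-− n f g = trans (∑-+ n f (λ i → - g i)) (+-congˡ (∑-neg n g))

  ∑-last : ∀ n (f : ℕ → Carrier) → ∑ (suc n) f ≈ ∑ n f + f n
  ∑-last zero f = trans (+-identityʳ _) (sym (+-identityˡ _))
  ∑-last (suc n) f = trans (+-congˡ (∑-last n _)) (sym (+-assoc _ _ _))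

  ∑-split : ∀ m n (f : ℕ → Carrier) → ∑ (m ℕ.+ n) f ≈ ∑ m f + ∑ n (λ i → f (m ℕ.+ i))
  ∑-split zero n f = sym (+-identityˡ _)
  ∑-split (suc m) n f = trans (+-congˡ (∑-split m n _)) (sym (+-assoc _ _ _))

  ∑₁-1# : ∀ n → ∑₁ n (λ _ → 1#) ≈ ιℕ n
  ∑₁-1# zero = refl
  ∑₁-1# (suc n) = +-congˡ (∑₁-1# n)

  sumR-applyUpTo : ∀ n (g : ℕ → Carrier) (f : ℕ → ℕ) → sumR (map g (applyUpTo f n)) ≈ ∑ n (g ∘ f)
  sumR-applyUpTo zero g f = refl
  sumR-applyUpTo (suc n) g f = +-congˡ (sumR-applyUpTo n g (f ∘ suc))

  sumR-range1 : ∀ A n (g : ℕ → Carrier) → sumR (map g (range1 A n)) ≈ ∑₁ n g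
  sumR-range1 A n g = sumR-applyUpTo n g suc

  sumR-filter : ∀ {a p} {X : Set a} {P : X → Set p} (P? : ∀ x → Dec (P x)) (g : X → Carrier) xs →
    sumR (map g (filter P? xs)) ≈ sumR (map (λ x → when (does (P? x)) (g x)) xs)
  sumR-filter P? g [] = refl
  sumR-filter P? g (x ∷ xs) with does (P? x)
  ... | true = +-congˡ (sumR-filter P? g xs)
  ... | false = trans (sumR-filter P? g xs) (sym (+-identityˡ _))

  sumR-cong : ∀ {a} {X : Set a} {f g : X → Carrier} xs → (∀ x → f x ≈ g x) →
    sumR (map f xs) ≈ sumR (map g xs)
  sumR-cong [] f≈g = refl
  sumR-cong (x ∷ xs) f≈g = +-cong (f≈g x) (sumR-cong xs f≈g)

  sumR-*ˡ : ∀ {a} {X : Set a} y (f : X → Carrier) xs → sumR (map (λ x → y * f x) xs) ≈ y * sumR (map f xs)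
  sumR-*ˡ y f [] = sym (zeroʳ y)
  sumR-*ˡ y f (x ∷ xs) = trans (+-congˡ (sumR-*ˡ y f xs)) (sym (distribˡ _ _ _))

  ιℕ-length : ∀ {a} {X : Set a} (xs : List X) → ιℕ (length xs) ≈ sumR (map (λ _ → 1#) xs)
  ιℕ-length [] = refl
  ιℕ-length (x ∷ xs) = +-congˡ (ιℕ-length xs)

  ιℕ-sum : ∀ xs → ιℕ (sum xs) ≈ sumR (map ιℕ xs)
  ιℕ-sum [] = refl
  ιℕ-sum (x ∷ xs) = trans (ιℕ-+ x (sum xs)) (+-congˡ (ιℕ-sum xs))

  prodR : List Carrier → Carrier
  prodR = foldr _*_ 1#

  prodR-cong : ∀ {a} {X : Set a} {f g : X → Carrier} xs → (∀ {x} → x ∈ xs → f x ≈ g x) →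
    prodR (map f xs) ≈ prodR (map g xs)
  prodR-cong [] f≈g = refl
  prodR-cong (x ∷ xs) f≈g = *-cong (f≈g (here ≡.refl)) (prodR-cong xs (f≈g ∘ there))

  ιℤ--1^ : ∀ k → ιℤ (-1^ k) ≈ pow (- 1#) k
  ιℤ--1^ zero = ιℕ-1
  ιℤ--1^ (suc k) = trans (ιℤ-neg (-1^ k)) (trans (-‿cong (ιℤ--1^ k)) (sym (-1*x≈-x _)))

  pow-−1-even : ∀ h → pow (- 1#) (2 ℕ.* h) ≈ 1#
  pow-−1-even h = begin
    pow (- 1#) (2 ℕ.* h)      ≈⟨ pow-* (- 1#) 2 h ⟩
    pow (pow (- 1#) 2) h      ≈⟨ pow-cong square h ⟩
    pow 1# h                  ≈⟨ pow-1# h ⟩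
    1#                        ∎
    where
    square : pow (- 1#) 2 ≈ 1#
    square = solve 0 (:- con (+ 1) :* (:- con (+ 1) :* con (+ 1)) := con (+ 1)) refl

module Newton {c ℓ : Level} (R : CommutativeRing c ℓ) where
  open CommutativeRing R
  open Poly R
  open Ring R

  shift : (ℕ → Carrier) → ℕ → Carrier
  shift a zero = 0#
  shift a (suc k) = a k

  coeff-+P : ∀ p q k → coeff (p +P q) k ≈ coeff p k + coeff q k
  coeff-+P [] q k = sym (+-identityˡ _)
  coeff-+P (a ∷ p) [] k = sym (+-identityʳ _)
  coeff-+P (a ∷ p) (b ∷ q) zero = refl
  coeff-+P (a ∷ p) (b ∷ q) (suc k) = coeff-+P p q k

  coeff-0∷ : ∀ p k → coeff (0# ∷ p) k ≈ shift (coeff p) k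
  coeff-0∷ p zero = refl
  coeff-0∷ p (suc k) = refl

  coeff-map-scale : ∀ z p k → coeff (map (λ a → - (z * a)) p) k ≈ - (z * coeff p k)
  coeff-map-scale z [] k = sym (trans (-‿cong (zeroʳ z)) -0#≈0#)
  coeff-map-scale z (a ∷ p) zero = refl
  coeff-map-scale z (a ∷ p) (suc k) = coeff-map-scale z p k

  coeff-mulLin : ∀ z p k → coeff (mulLin z p) k ≈ shift (coeff p) k - z * coeff p k
  coeff-mulLin z p k = trans (coeff-+P (0# ∷ p) (map (λ a → - (z * a)) p) k) (+-cong (coeff-0∷ p k) (coeff-map-scale z p k))

  coeff-zero-prodLin-pow : ∀ ζ xs → coeff (prodLin (map (pow ζ) xs)) 0 ≈ pow (- 1#) (length xs) * pow ζ (sum xs)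
  coeff-zero-prodLin-pow ζ [] = sym (*-identityˡ _)
  coeff-zero-prodLin-pow ζ (x ∷ xs) = begin
    coeff (mulLin (pow ζ x) (prodLin (map (pow ζ) xs))) 0  ≈⟨ coeff-mulLin (pow ζ x) (prodLin (map (pow ζ) xs)) 0 ⟩
    0# - pow ζ x * coeff (prodLin (map (pow ζ) xs)) 0     ≈⟨ +-congˡ (-‿cong (*-congˡ (coeff-zero-prodLin-pow ζ xs))) ⟩
    0# - pow ζ x * (pow (- 1#) (length xs) * pow ζ (sum xs))
      ≈⟨ regroup (pow ζ x) (pow (- 1#) (length xs)) (pow ζ (sum xs)) ⟩
    (- 1# * pow (- 1#) (length xs)) * (pow ζ x * pow ζ (sum xs))
      ≈⟨ *-congˡ (pow-+ ζ x (sum xs)) ⟨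
    pow (- 1#) (length (x ∷ xs)) * pow ζ (sum (x ∷ xs))    ∎
    where
    regroup : ∀ z s t → 0# - z * (s * t) ≈ (- 1# * s) * (z * t)
    regroup = solve 3 (λ z s t → con (+ 0) :- z :* (s :* t) := (:- con (+ 1) :* s) :* (z :* t)) refl

  conv : (ℕ → Carrier) → (ℕ → Carrier) → ℕ → Carrier
  conv a s k = ∑₁ k (λ j → a (k ∸ j) * s j)

  conv-congˡ : ∀ {a b : ℕ → Carrier} s → (∀ k → a k ≈ b k) → ∀ k → conv a s k ≈ conv b s k
  conv-congˡ s a≈b k = ∑-cong k (λ i → *-congʳ (a≈b _))

  conv-+ʳ : ∀ a (s t : ℕ → Carrier) k → conv a (λ j → s j + t j) k ≈ conv a s k + conv a t k
  conv-+ʳ a s t k = trans (∑-cong k (λ i → distribˡ _ _ _)) (∑-+ k _ _)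

  conv-shift : ∀ a s k → conv (shift a) s (suc k) ≈ conv a s k
  conv-shift a s k = begin
    ∑ (suc k) (λ i → shift a (k ∸ i) * s (suc i))             ≈⟨ ∑-last k _ ⟩
    ∑ k (λ i → shift a (k ∸ i) * s (suc i)) + shift a (k ∸ k) * s (suc k)
      ≈⟨ +-cong (∑-cong< k (λ i i<k → *-congʳ (reflexive (≡.cong (shift a) (k∸i≡1+k∸1+i i<k)))))
                (*-congʳ (reflexive (≡.cong (shift a) (ℕ.n∸n≡0 k)))) ⟩
    conv a s k + 0# * s (suc k)                                ≈⟨ +-congˡ (zeroˡ _) ⟩
    conv a s k + 0#                                            ≈⟨ +-identityʳ _ ⟩
    conv a s k                                                 ∎
    where
    k∸i≡1+k∸1+i : ∀ {k i} → i ℕ.< k → k ∸ i ≡ suc (k ∸ suc i)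
    k∸i≡1+k∸1+i {suc k} {zero} _ = ≡.refl
    k∸i≡1+k∸1+i {suc k} {suc i} (ℕ.s≤s i<k) = k∸i≡1+k∸1+i i<k

  conv-mulLin : ∀ z p (s : ℕ → Carrier) k →
    conv (coeff (mulLin z p)) s (suc k) ≈ conv (coeff p) s k - z * conv (coeff p) s (suc k)
  conv-mulLin z p s k = begin
    conv (coeff (mulLin z p)) s (suc k)
      ≈⟨ conv-congˡ s (coeff-mulLin z p) (suc k) ⟩
    ∑ (suc k) (λ i → (shift a (k ∸ i) - z * a (k ∸ i)) * s (suc i))
      ≈⟨ ∑-cong (suc k) (λ i → distrib-− (shift a (k ∸ i)) (a (k ∸ i)) z (s (suc i))) ⟩
    ∑ (suc k) (λ i → shift a (k ∸ i) * s (suc i) - z * (a (k ∸ i) * s (suc i)))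
      ≈⟨ ∑-− (suc k) (λ i → shift a (k ∸ i) * s (suc i)) (λ i → z * (a (k ∸ i) * s (suc i))) ⟩
    conv (shift a) s (suc k) - ∑ (suc k) (λ i → z * (a (k ∸ i) * s (suc i)))
      ≈⟨ +-cong (conv-shift a s k) (-‿cong (∑-*ˡ (suc k) z (λ i → a (k ∸ i) * s (suc i)))) ⟩
    conv a s k - z * conv a s (suc k)
      ∎
    where
    a = coeff p
    distrib-− : ∀ x y z s → (x - z * y) * s ≈ x * s - z * (y * s)
    distrib-− = solve 4 (λ x y z s → (x :- z :* y) :* s := x :* s :- z :* (y :* s)) refl

  conv-pow : ∀ (a : ℕ → Carrier) w k → conv a (pow w) (suc k) ≈ w * (a k + conv a (pow w) k)
  conv-pow a w k = begin
    a k * (w * 1#) + ∑ k (λ i → a (k ∸ suc i) * (w * pow w (suc i)))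
      ≈⟨ +-cong (rotate₁ (a k) w) (∑-cong k (λ i → rotate₂ (a (k ∸ suc i)) w (pow w (suc i)))) ⟩
    w * a k + ∑ k (λ i → w * (a (k ∸ suc i) * pow w (suc i)))
      ≈⟨ +-congˡ (∑-*ˡ k w _) ⟩
    w * a k + w * conv a (pow w) k
      ≈⟨ sym (distribˡ _ _ _) ⟩
    w * (a k + conv a (pow w) k)
      ∎
    where
    rotate₁ : ∀ a w → a * (w * 1#) ≈ w * a
    rotate₁ = solve 2 (λ a w → a :* (w :* con (+ 1)) := w :* a) refl
    rotate₂ : ∀ a w p → a * (w * p) ≈ w * (a * p)
    rotate₂ = solve 3 (λ a w p → a :* (w :* p) := w :* (a :* p)) refl

  conv-mulLin-pow : ∀ z w p k → z * w ≈ 1# →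
    conv (coeff (mulLin z p)) (pow w) (suc k) ≈ - coeff p k
  conv-mulLin-pow z w p k zw≈1 = begin
    conv (coeff (mulLin z p)) (pow w) (suc k) ≈⟨ conv-mulLin z p (pow w) k ⟩
    G - z * conv a (pow w) (suc k)            ≈⟨ +-congˡ (-‿cong (*-congˡ (conv-pow a w k))) ⟩
    G - z * (w * (a k + G))                   ≈⟨ +-congˡ (-‿cong (trans (sym (*-assoc _ _ _)) (*-congʳ zw≈1))) ⟩
    G - 1# * (a k + G)                        ≈⟨ cancel (a k) G ⟩
    - a k                                     ∎
    where
    a = coeff p
    G = conv a (pow w) k
    cancel : ∀ x g → g - 1# * (x + g) ≈ - x
    cancel = solve 2 (λ x g → g :- con (+ 1) :* (x :+ g) := :- x) refl

  powerSum : ∀ {i} {I : Set i} → (I → Carrier) → List I → ℕ → Carrier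
  powerSum w xs j = sumR (map (λ x → pow (w x) j) xs)

  newton : ∀ {i} {I : Set i} (z w : I → Carrier) xs → All (λ x → z x * w x ≈ 1#) xs → ∀ k →
    let a = coeff (prodLin (map z xs)) in
    ιℕ k * a k + conv a (powerSum w xs) k ≈ 0#
  newton z w xs zw≈1 zero = trans (+-identityʳ _) (zeroˡ _)
  newton z w [] [] (suc k) = begin
    ιℕ (suc k) * 0# + ∑ (suc k) (λ i → coeff (1# ∷ []) (k ∸ i) * 0#)
      ≈⟨ +-cong (zeroʳ _) (∑-zero (suc k) (λ i _ → zeroʳ (coeff (1# ∷ []) (k ∸ i)))) ⟩
    0# + 0#
      ≈⟨ +-identityʳ _ ⟩
    0# ∎
  newton z w (x ∷ xs) (zw≈1 ∷ zws≈1) (suc k) = begin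
    ιℕ (suc k) * a′ (suc k) + conv a′ (λ j → pow (w x) j + s j) (suc k)
      ≈⟨ +-cong (*-congˡ (coeff-mulLin (z x) p (suc k))) (conv-+ʳ a′ (pow (w x)) s (suc k)) ⟩
    ιℕ (suc k) * (a k - z x * a (suc k)) + (conv a′ (pow (w x)) (suc k) + conv a′ s (suc k))
      ≈⟨ +-congˡ (+-cong (conv-mulLin-pow (z x) (w x) p k zw≈1) (conv-mulLin (z x) p s k)) ⟩
    ιℕ (suc k) * (a k - z x * a (suc k)) + (- a k + (conv a s k - z x * conv a s (suc k)))
      ≈⟨ +-congˡ (+-congˡ (+-cong (IH k) (-‿cong (*-congˡ (IH (suc k)))))) ⟩
    (1# + ιℕ k) * (a k - z x * a (suc k)) + (- a k + (- (ιℕ k * a k) - z x * - ((1# + ιℕ k) * a (suc k))))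
      ≈⟨ collect (ιℕ k) (a k) (a (suc k)) (z x) ⟩
    0# ∎
    where
    p = prodLin (map z xs)
    a = coeff p
    a′ = coeff (mulLin (z x) p)
    s = powerSum w xs
    IH : ∀ k → conv a s k ≈ - (ιℕ k * a k)
    IH k = +-inverseʳ-unique _ _ (newton z w xs zws≈1 k)
    collect : ∀ K A A′ c → (1# + K) * (A - c * A′) + (- A + (- (K * A) - c * - ((1# + K) * A′))) ≈ 0#
    collect = solve 4 (λ K A A′ c →
      (con (+ 1) :+ K) :* (A :- c :* A′) :+ (:- A :+ (:- (K :* A) :- c :* (:- ((con (+ 1) :+ K) :* A′))))
        := con (+ 0)) refl

module Roots {c ℓ : Level} (R : CommutativeRing c ℓ) where
  open CommutativeRing R
  open Poly R
  open Ring R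

  geometric-sum : ∀ ω K → (ω - 1#) * ∑₁ K (pow ω) ≈ pow ω (suc K) - ω
  geometric-sum ω zero = trans (zeroʳ _) (sym (trans (+-congʳ (*-identityʳ ω)) (-‿inverseʳ ω)))
  geometric-sum ω (suc K) = begin
    (ω - 1#) * (ω * 1# + ∑ K (λ i → ω * pow ω (suc i)))  ≈⟨ *-congˡ (+-congˡ (∑-*ˡ K ω _)) ⟩
    (ω - 1#) * (ω * 1# + ω * ∑₁ K (pow ω))               ≈⟨ expand ω (∑₁ K (pow ω)) ⟩
    (ω - 1#) * ω + ω * ((ω - 1#) * ∑₁ K (pow ω))         ≈⟨ +-congˡ (*-congˡ (geometric-sum ω K)) ⟩
    (ω - 1#) * ω + ω * (pow ω (suc K) - ω)               ≈⟨ contract ω (pow ω (suc K)) ⟩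
    pow ω (suc (suc K)) - ω                              ∎
    where
    expand : ∀ w T → (w - 1#) * (w * 1# + w * T) ≈ (w - 1#) * w + w * ((w - 1#) * T)
    expand = solve 2 (λ w T → (w :- con (+ 1)) :* (w :* con (+ 1) :+ w :* T)
                            := (w :- con (+ 1)) :* w :+ w :* ((w :- con (+ 1)) :* T)) refl
    contract : ∀ w P → (w - 1#) * w + w * (P - w) ≈ w * P - w
    contract = solve 2 (λ w P → (w :- con (+ 1)) :* w :+ w :* (P :- w) := w :* P :- w) refl

  module IntegralDomain (D : IntegralDomainChar0) where

    private
      noZeroDivisors : ∀ x y → x * y ≈ 0# → x ≈ 0# ⊎ y ≈ 0#
      noZeroDivisors = proj₁ (proj₂ D)

    ιℕ-injective : ∀ m n → ιℕ m ≈ ιℕ n → m ≡ n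
    ιℕ-injective zero zero _ = ≡.refl
    ιℕ-injective zero (suc n) e = ⊥-elim (proj₂ (proj₂ D) n (sym e))
    ιℕ-injective (suc m) zero e = ⊥-elim (proj₂ (proj₂ D) m e)
    ιℕ-injective (suc m) (suc n) e = ≡.cong suc (ιℕ-injective m n (+-cancelˡ 1# _ _ e))

    geometric-sum-zero : ∀ ω K → pow ω K ≈ 1# → ¬ (ω ≈ 1#) → ∑₁ K (pow ω) ≈ 0#
    geometric-sum-zero ω K ωᴷ≈1 ω≉1 with noZeroDivisors (ω - 1#) (∑₁ K (pow ω)) product≈0
      where
      product≈0 : (ω - 1#) * ∑₁ K (pow ω) ≈ 0#
      product≈0 = begin
        (ω - 1#) * ∑₁ K (pow ω)  ≈⟨ geometric-sum ω K ⟩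
        ω * pow ω K - ω          ≈⟨ +-congʳ (trans (*-congˡ ωᴷ≈1) (*-identityʳ ω)) ⟩
        ω - ω                    ≈⟨ -‿inverseʳ ω ⟩
        0#                       ∎
    ... | inj₁ ω-1≈0 = ⊥-elim (ω≉1 (x∙y⁻¹≈ε⇒x≈y ω 1# ω-1≈0))
    ... | inj₂ sum≈0 = sum≈0

    primitiveRoot-order : ∀ {n ζ} .{{_ : ℕ.NonZero n}} → PrimitiveRoot n ζ →
      ∀ k → pow ζ k ≈ 1# → n ∣ k
    primitiveRoot-order {n} {ζ} (ζⁿ≈1 , minimal) k ζᵏ≈1 with k % n in eq
    ... | zero = m%n≡0⇒n∣m k n eq
    ... | suc r = ⊥-elim (minimal (suc r) (ℕ.s≤s ℕ.z≤n) (≡.subst (ℕ._< n) eq (m%n<n k n)) ζʳ⁺¹≈1)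
      where
      ζʳ⁺¹≈1 : pow ζ (suc r) ≈ 1#
      ζʳ⁺¹≈1 = begin
        pow ζ (suc r)                              ≈⟨ sym (*-identityʳ _) ⟩
        pow ζ (suc r) * 1#                         ≈⟨ *-congˡ (sym (pow-root-of-unity n ζⁿ≈1 (k / n))) ⟩
        pow ζ (suc r) * pow ζ (n ℕ.* (k / n))      ≈⟨ sym (pow-+ ζ (suc r) _) ⟩
        pow ζ (suc r ℕ.+ n ℕ.* (k / n))            ≡⟨ ≡.cong (pow ζ) (≡.trans (≡.cong₂ ℕ._+_ (≡.sym eq) (ℕ.*-comm n (k / n)))
                                                                         (≡.sym (m≡m%n+[m/n]*n k n))) ⟩
        pow ζ k                                    ≈⟨ ζᵏ≈1 ⟩
        1#                                         ∎

    square-root-of-one : ∀ x → x * x ≈ 1# → ¬ (x ≈ 1#) → x ≈ - 1#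
    square-root-of-one x x²≈1 x≉1 with noZeroDivisors (x - 1#) (x + 1#) product≈0
      where
      difference-of-squares : ∀ x → (x - 1#) * (x + 1#) ≈ x * x - 1#
      difference-of-squares = solve 1 (λ x → (x :- con (+ 1)) :* (x :+ con (+ 1)) := x :* x :- con (+ 1)) refl
      product≈0 : (x - 1#) * (x + 1#) ≈ 0#
      product≈0 = trans (difference-of-squares x) (trans (+-congʳ x²≈1) (-‿inverseʳ 1#))
    ... | inj₁ x-1≈0 = ⊥-elim (x≉1 (x∙y⁻¹≈ε⇒x≈y x 1# x-1≈0))
    ... | inj₂ x+1≈0 = +-inverseˡ-unique x 1# x+1≈0

    -- ω = ζ^{c m} is a K-th root of unity, and ω = 1 exactly when K ∣ m.
    ∑-roots-of-unity : ∀ {n ζ} → 1 ≤ n → PrimitiveRoot n ζ → ∀ m c K → c ℕ.* K ≡ n →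
      ∑₁ K (λ u → pow ζ (c ℕ.* u ℕ.* m)) ≈ ιℕ K * [ K ∣ m ]
    ∑-roots-of-unity 1≤n _ m zero K ≡.refl = ⊥-elim (ℕ.<⇒≱ 1≤n ℕ.z≤n)
    ∑-roots-of-unity {n} {ζ} 1≤n prim@(ζⁿ≈1 , _) m c@(suc _) K cK≡n =
      trans (∑-cong K (λ u → ζᶜᵘᵐ≈ωᵘ (suc u))) (by-cases (K ∣? m))
      where
      ω = pow ζ (c ℕ.* m)
      ζᶜᵘᵐ≈ωᵘ : ∀ u → pow ζ (c ℕ.* u ℕ.* m) ≈ pow ω u
      ζᶜᵘᵐ≈ωᵘ u = trans (reflexive (≡.cong (pow ζ) (rearrange c u m))) (pow-* ζ (c ℕ.* m) u)
        where
        rearrange : ∀ c u m → c ℕ.* u ℕ.* m ≡ c ℕ.* m ℕ.* u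
        rearrange = solve-∀
      ωᴷ≈1 : pow ω K ≈ 1#
      ωᴷ≈1 = begin
        pow ω K                  ≈⟨ pow-* ζ (c ℕ.* m) K ⟨
        pow ζ (c ℕ.* m ℕ.* K)    ≡⟨ ≡.cong (pow ζ) (≡.trans (rearrange c m K) (≡.cong (ℕ._* m) cK≡n)) ⟩
        pow ζ (n ℕ.* m)          ≈⟨ pow-root-of-unity n ζⁿ≈1 m ⟩
        1#                       ∎
        where
        rearrange : ∀ c m K → c ℕ.* m ℕ.* K ≡ c ℕ.* K ℕ.* m
        rearrange = solve-∀
      by-cases : (K∣?m : Dec (K ∣ m)) → ∑₁ K (pow ω) ≈ ιℕ K * when (does K∣?m) 1#
      by-cases (yes (divides t ≡.refl)) = begin
        ∑₁ K (pow ω)           ≈⟨ ∑-cong K (λ u → trans (pow-cong ω≈1 (suc u)) (pow-1# (suc u))) ⟩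
        ∑₁ K (λ _ → 1#)        ≈⟨ ∑₁-1# K ⟩
        ιℕ K                   ≈⟨ *-identityʳ _ ⟨
        ιℕ K * 1#              ∎
        where
        ω≈1 : ω ≈ 1#
        ω≈1 = trans (reflexive (≡.cong (pow ζ) (≡.trans (rearrange c t K) (≡.cong (ℕ._* t) cK≡n))))
                    (pow-root-of-unity n ζⁿ≈1 t)
          where
          rearrange : ∀ c t K → c ℕ.* (t ℕ.* K) ≡ c ℕ.* K ℕ.* t
          rearrange = solve-∀
      by-cases (no K∤m) = trans (geometric-sum-zero ω K ωᴷ≈1 ω≉1) (sym (zeroʳ _))
        where
        ω≉1 : ¬ (ω ≈ 1#)
        ω≉1 ω≈1 = K∤m (*-cancelˡ-∣ c (≡.subst (_∣ c ℕ.* m) (≡.sym cK≡n)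
                        (primitiveRoot-order {{ℕ.>-nonZero 1≤n}} prim (c ℕ.* m) ω≈1)))

    primitiveRoot-half : ∀ {m ζ} → 1 ≤ m → PrimitiveRoot (2 ℕ.* m) ζ → pow ζ m ≈ - 1#
    primitiveRoot-half {m} {ζ} 1≤m (ζ²ᵐ≈1 , minimal) = square-root-of-one (pow ζ m) ζᵐ*ζᵐ≈1 (minimal m 1≤m m<2m)
      where
      m<2m : m ℕ.< 2 ℕ.* m
      m<2m = ℕ.m<m+n m (ℕ.≤-trans 1≤m (ℕ.m≤m+n m 0))
      ζᵐ*ζᵐ≈1 : pow ζ m * pow ζ m ≈ 1#
      ζᵐ*ζᵐ≈1 = begin
        pow ζ m * pow ζ m    ≈⟨ pow-+ ζ m m ⟨
        pow ζ (m ℕ.+ m)      ≡⟨ ≡.cong (λ t → pow ζ (m ℕ.+ t)) (ℕ.+-identityʳ m) ⟨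
        pow ζ (2 ℕ.* m)      ≈⟨ ζ²ᵐ≈1 ⟩
        1#                   ∎

    -1^φ*ζ^s≈1 : ∀ {n ζ} → 1 ≤ n → PrimitiveRoot n ζ → ∀ s φ → 2 ℕ.* s ≡ n ℕ.* φ →
      pow (- 1#) φ * pow ζ s ≈ 1#
    -1^φ*ζ^s≈1 {n} {ζ} 1≤n prim@(ζⁿ≈1 , _) s φ 2s≡nφ with even-or-odd φ | even-or-odd n
    ... | h , inj₁ ≡.refl | _ = begin
      pow (- 1#) (2 ℕ.* h) * pow ζ s   ≈⟨ *-cong (pow-−1-even h) (reflexive (≡.cong (pow ζ) s≡nh)) ⟩
      1# * pow ζ (n ℕ.* h)             ≈⟨ *-identityˡ _ ⟩
      pow ζ (n ℕ.* h)                  ≈⟨ pow-root-of-unity n ζⁿ≈1 h ⟩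
      1#                               ∎
      where
      s≡nh : s ≡ n ℕ.* h
      s≡nh = ℕ.*-cancelˡ-≡ s (n ℕ.* h) 2 (≡.trans 2s≡nφ (rearrange n h))
        where
        rearrange : ∀ n h → n ℕ.* (2 ℕ.* h) ≡ 2 ℕ.* (n ℕ.* h)
        rearrange = solve-∀
    ... | h , inj₂ ≡.refl | k , inj₂ ≡.refl =
      ⊥-elim (ℕ.even≢odd s (k ℕ.+ h ℕ.+ 2 ℕ.* k ℕ.* h) (≡.trans 2s≡nφ (rearrange k h)))
      where
      rearrange : ∀ k h → suc (2 ℕ.* k) ℕ.* suc (2 ℕ.* h) ≡ suc (2 ℕ.* (k ℕ.+ h ℕ.+ 2 ℕ.* k ℕ.* h))
      rearrange = solve-∀
    ... | _ , inj₂ _ | m , inj₁ ≡.refl = begin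
      pow (- 1#) φ * pow ζ s            ≡⟨ ≡.cong (λ t → pow (- 1#) φ * pow ζ t) s≡mφ ⟩
      pow (- 1#) φ * pow ζ (m ℕ.* φ)    ≈⟨ *-congˡ (trans (pow-* ζ m φ) (pow-cong ζᵐ≈-1 φ)) ⟩
      pow (- 1#) φ * pow (- 1#) φ       ≈⟨ pow-+ (- 1#) φ φ ⟨
      pow (- 1#) (φ ℕ.+ φ)              ≡⟨ ≡.cong (pow (- 1#)) (≡.cong (φ ℕ.+_) (≡.sym (ℕ.+-identityʳ φ))) ⟩
      pow (- 1#) (2 ℕ.* φ)              ≈⟨ pow-−1-even φ ⟩
      1#                                ∎
      where
      s≡mφ : s ≡ m ℕ.* φ
      s≡mφ = ℕ.*-cancelˡ-≡ s (m ℕ.* φ) 2 (≡.trans 2s≡nφ (ℕ.*-assoc 2 m φ))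
      1≤m : 1 ≤ m
      1≤m = half-positive m 1≤n
        where
        half-positive : ∀ m → 1 ≤ 2 ℕ.* m → 1 ≤ m
        half-positive (suc _) _ = ℕ.s≤s ℕ.z≤n
      ζᵐ≈-1 : pow ζ m ≈ - 1#
      ζᵐ≈-1 = primitiveRoot-half 1≤m prim

module Sieve {c ℓ : Level} (R : CommutativeRing c ℓ) where
  open CommutativeRing R
  open Poly R
  open Ring R

  sieve : List ℕ → ℕ → (ℕ → Carrier) → Carrier
  sieve qs N F = ∑₁ N (λ u → when (avoids qs u) (F u))

  sieve-cong : ∀ qs N {F F′ : ℕ → Carrier} → (∀ u → F u ≈ F′ u) → sieve qs N F ≈ sieve qs N F′
  sieve-cong qs N F≈F′ = ∑-cong N (λ i → when-cong (avoids qs (suc i)) (F≈F′ (suc i)))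

  ∑₁-multiples : ∀ q N (G : ℕ → Carrier) → 1 ≤ q →
    ∑₁ (q ℕ.* N) (λ u → when (does (q ∣? u)) (G u)) ≈ ∑₁ N (λ i → G (q ℕ.* i))
  ∑₁-multiples q zero G _ rewrite ℕ.*-zeroʳ q = refl
  ∑₁-multiples (suc p) (suc N) G _ = begin
    ∑₁ (q ℕ.* suc N) (λ u → when (does (q ∣? u)) (G u))
      ≡⟨ ≡.cong (λ m → ∑₁ m (λ u → when (does (q ∣? u)) (G u))) (ℕ.*-suc q N) ⟩
    ∑ (q ℕ.+ q ℕ.* N) (λ i → when (does (q ∣? suc i)) (G (suc i)))
      ≈⟨ ∑-split q (q ℕ.* N) (λ i → when (does (q ∣? suc i)) (G (suc i))) ⟩
    ∑₁ q (λ u → when (does (q ∣? u)) (G u)) + ∑ (q ℕ.* N) (λ i → when (does (q ∣? suc (q ℕ.+ i))) (G (suc (q ℕ.+ i))))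
      ≈⟨ +-cong first-block (∑-cong (q ℕ.* N) shift-by-q) ⟩
    G q + ∑₁ (q ℕ.* N) (λ u → when (does (q ∣? u)) (G (q ℕ.+ u)))
      ≈⟨ +-cong (reflexive (≡.cong G (≡.sym (ℕ.*-identityʳ q)))) (∑₁-multiples q N (G ∘ (q ℕ.+_)) (ℕ.s≤s ℕ.z≤n)) ⟩
    G (q ℕ.* 1) + ∑₁ N (λ i → G (q ℕ.+ q ℕ.* i))
      ≈⟨ +-congˡ (∑-cong N (λ i → reflexive (≡.cong G (≡.sym (ℕ.*-suc q (suc i)))))) ⟩
    ∑₁ (suc N) (λ i → G (q ℕ.* i))
      ∎
    where
    q = suc p
    q∤1+i : ∀ {i} → i ℕ.< p → ¬ q ∣ suc i
    q∤1+i i<p q∣1+i = ℕ.<⇒≱ i<p (ℕ.≤-pred (∣⇒≤ q∣1+i))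
    first-block : ∑₁ q (λ u → when (does (q ∣? u)) (G u)) ≈ G q
    first-block = begin
      ∑ (suc p) (λ i → when (does (q ∣? suc i)) (G (suc i)))
        ≈⟨ ∑-last p _ ⟩
      ∑ p (λ i → when (does (q ∣? suc i)) (G (suc i))) + when (does (q ∣? q)) (G q)
        ≈⟨ +-cong (∑-zero p (λ i i<p → when-≡ _ (dec-false (q ∣? suc i) (q∤1+i i<p))))
                  (when-≡ _ (dec-true (q ∣? q) ∣-refl)) ⟩
      0# + G q
        ≈⟨ +-identityˡ _ ⟩
      G q ∎
    shift-by-q : ∀ i →
      when (does (q ∣? suc (q ℕ.+ i))) (G (suc (q ℕ.+ i))) ≈ when (does (q ∣? suc i)) (G (q ℕ.+ suc i))
    shift-by-q i rewrite ≡.sym (ℕ.+-suc q i) =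
      when-≡ _ (does-⇔ (mk⇔ (λ h → ∣m+n∣m⇒∣n h ∣-refl) (∣m∣n⇒∣m+n ∣-refl)) (q ∣? q ℕ.+ suc i) (q ∣? suc i))

  when-not∧ : ∀ a b x → when (not a ∧ b) x ≈ when b x - when a (when b x)
  when-not∧ true true x = sym (-‿inverseʳ x)
  when-not∧ true false x = sym (trans (+-identityˡ _) -0#≈0#)
  when-not∧ false b x = sym (trans (+-congˡ -0#≈0#) (+-identityʳ _))

  avoids-* : ∀ q qs → All (λ q′ → Coprime q′ q) qs → ∀ i → avoids qs (q ℕ.* i) ≡ avoids qs i
  avoids-* q [] [] i = ≡.refl
  avoids-* q (q′ ∷ qs) (q′⊥q ∷ qs⊥q) i =
    ≡.cong₂ (λ a b → not a ∧ b)
      (does-⇔ (mk⇔ (coprime-divisor q′⊥q) (∣n⇒∣m*n q)) (q′ ∣? q ℕ.* i) (q′ ∣? i))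
      (avoids-* q qs qs⊥q i)

  sieve-∷ : ∀ q qs → 1 ≤ q → All (λ q′ → Coprime q′ q) qs → ∀ M F →
    sieve (q ∷ qs) (q ℕ.* M) F ≈ sieve qs (q ℕ.* M) F - sieve qs M (F ∘ (q ℕ.*_))
  sieve-∷ q qs 1≤q qs⊥q M F = begin
    sieve (q ∷ qs) (q ℕ.* M) F
      ≈⟨ ∑-cong (q ℕ.* M) (λ i → when-not∧ (does (q ∣? suc i)) (avoids qs (suc i)) _) ⟩
    ∑₁ (q ℕ.* M) (λ u → when (avoids qs u) (F u) - when (does (q ∣? u)) (when (avoids qs u) (F u)))
      ≈⟨ ∑-− (q ℕ.* M) (λ i → when (avoids qs (suc i)) (F (suc i)))
                        (λ i → when (does (q ∣? suc i)) (when (avoids qs (suc i)) (F (suc i)))) ⟩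
    sieve qs (q ℕ.* M) F - ∑₁ (q ℕ.* M) (λ u → when (does (q ∣? u)) (when (avoids qs u) (F u)))
      ≈⟨ +-congˡ (-‿cong (∑₁-multiples q M (λ u → when (avoids qs u) (F u)) 1≤q)) ⟩
    sieve qs (q ℕ.* M) F - ∑₁ M (λ i → when (avoids qs (q ℕ.* i)) (F (q ℕ.* i)))
      ≈⟨ +-congˡ (-‿cong (∑-cong M (λ i → when-≡ _ (avoids-* q qs qs⊥q (suc i))))) ⟩
    sieve qs (q ℕ.* M) F - sieve qs M (F ∘ (q ℕ.*_))
      ∎

  -- signedSubsetSum B qs K = ∑_{T ⊆ qs} (-1)^{|qs| - |T|} B (K · ∏ T)
  signedSubsetSum : (ℕ → Carrier) → List ℕ → ℕ → Carrier
  signedSubsetSum B [] K = B K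
  signedSubsetSum B (q ∷ qs) K = signedSubsetSum B qs (q ℕ.* K) - signedSubsetSum B qs K

  -- B K is the sum of G over the multiples of c = n / K up to n.
  sieve-signedSubsetSum : ∀ (G B : ℕ → Carrier) n →
    (∀ c K → c ℕ.* K ≡ n → ∑₁ K (λ u → G (c ℕ.* u)) ≈ B K) →
    ∀ qs → AllPairs Coprime qs → All (1 ≤_) qs → ∀ c K → c ℕ.* (product qs ℕ.* K) ≡ n →
    sieve qs (product qs ℕ.* K) (λ u → G (c ℕ.* u)) ≈ signedSubsetSum B qs K
  sieve-signedSubsetSum G B n blocks [] [] [] c K cK≡n rewrite ℕ.+-identityʳ K = blocks c K cK≡n
  sieve-signedSubsetSum G B n blocks (q ∷ qs) (q⊥qs ∷ qs-coprime) (1≤q ∷ 1≤qs) c K cqPK≡n = begin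
    sieve (q ∷ qs) (q ℕ.* P ℕ.* K) (λ u → G (c ℕ.* u))
      ≡⟨ ≡.cong (λ m → sieve (q ∷ qs) m (λ u → G (c ℕ.* u))) (ℕ.*-assoc q P K) ⟩
    sieve (q ∷ qs) (q ℕ.* (P ℕ.* K)) (λ u → G (c ℕ.* u))
      ≈⟨ sieve-∷ q qs 1≤q (All.map Coprime.sym q⊥qs) (P ℕ.* K) (λ u → G (c ℕ.* u)) ⟩
    sieve qs (q ℕ.* (P ℕ.* K)) (λ u → G (c ℕ.* u)) - sieve qs (P ℕ.* K) (λ i → G (c ℕ.* (q ℕ.* i)))
      ≈⟨ +-cong (reflexive (≡.cong (λ m → sieve qs m (λ u → G (c ℕ.* u))) (rearrange₁ q P K)))
                (-‿cong (sieve-cong qs (P ℕ.* K) (λ i → reflexive (≡.cong G (≡.sym (ℕ.*-assoc c q i)))))) ⟩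
    sieve qs (P ℕ.* (q ℕ.* K)) (λ u → G (c ℕ.* u)) - sieve qs (P ℕ.* K) (λ i → G (c ℕ.* q ℕ.* i))
      ≈⟨ +-cong (IH c (q ℕ.* K) (≡.trans (rearrange₂ c q P K) cqPK≡n))
                (-‿cong (IH (c ℕ.* q) K (≡.trans (rearrange₃ c q P K) cqPK≡n))) ⟩
    signedSubsetSum B (q ∷ qs) K
      ∎
    where
    P = product qs
    IH = sieve-signedSubsetSum G B n blocks qs qs-coprime 1≤qs
    rearrange₁ : ∀ q P K → q ℕ.* (P ℕ.* K) ≡ P ℕ.* (q ℕ.* K)
    rearrange₁ = solve-∀
    rearrange₂ : ∀ c q P K → c ℕ.* (P ℕ.* (q ℕ.* K)) ≡ c ℕ.* (q ℕ.* P ℕ.* K)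
    rearrange₂ = solve-∀
    rearrange₃ : ∀ c q P K → c ℕ.* q ℕ.* (P ℕ.* K) ≡ c ℕ.* (q ℕ.* P ℕ.* K)
    rearrange₃ = solve-∀

  sieve-product : ∀ (G B : ℕ → Carrier) qs → AllPairs Coprime qs → All (1 ≤_) qs →
    (∀ c K → c ℕ.* K ≡ product qs → ∑₁ K (λ u → G (c ℕ.* u)) ≈ B K) →
    sieve qs (product qs) G ≈ signedSubsetSum B qs 1
  sieve-product G B qs qs-coprime 1≤qs blocks = begin
    sieve qs (product qs) G
      ≈⟨ sieve-cong qs (product qs) (λ u → reflexive (≡.cong G (≡.sym (ℕ.*-identityˡ u)))) ⟩
    sieve qs (product qs) (λ u → G (1 ℕ.* u))
      ≡⟨ ≡.cong (λ m → sieve qs m (λ u → G (1 ℕ.* u))) (≡.sym (ℕ.*-identityʳ (product qs))) ⟩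
    sieve qs (product qs ℕ.* 1) (λ u → G (1 ℕ.* u))
      ≈⟨ sieve-signedSubsetSum G B (product qs) blocks qs qs-coprime 1≤qs 1 1 (unit-factors (product qs)) ⟩
    signedSubsetSum B qs 1
      ∎
    where
    unit-factors : ∀ n → 1 ℕ.* (n ℕ.* 1) ≡ n
    unit-factors = solve-∀

  signedSubsetSum-+ : ∀ (B B′ : ℕ → Carrier) qs K →
    signedSubsetSum (λ K → B K + B′ K) qs K ≈ signedSubsetSum B qs K + signedSubsetSum B′ qs K
  signedSubsetSum-+ B B′ [] K = refl
  signedSubsetSum-+ B B′ (q ∷ qs) K = begin
    signedSubsetSum (λ K → B K + B′ K) qs (q ℕ.* K) - signedSubsetSum (λ K → B K + B′ K) qs K
      ≈⟨ +-cong (signedSubsetSum-+ B B′ qs (q ℕ.* K)) (-‿cong (signedSubsetSum-+ B B′ qs K)) ⟩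
    (S (q ℕ.* K) + S′ (q ℕ.* K)) - (S K + S′ K)
      ≈⟨ regroup (S (q ℕ.* K)) (S′ (q ℕ.* K)) (S K) (S′ K) ⟩
    (S (q ℕ.* K) - S K) + (S′ (q ℕ.* K) - S′ K)
      ∎
    where
    S = signedSubsetSum B qs
    S′ = signedSubsetSum B′ qs
    regroup : ∀ a b x y → (a + b) - (x + y) ≈ (a - x) + (b - y)
    regroup = solve 4 (λ a b x y → (a :+ b) :- (x :+ y) := (a :- x) :+ (b :- y)) refl

  signedSubsetSum-*ˡ : ∀ x (B : ℕ → Carrier) qs K →
    signedSubsetSum (λ K → x * B K) qs K ≈ x * signedSubsetSum B qs K
  signedSubsetSum-*ˡ x B [] K = refl
  signedSubsetSum-*ˡ x B (q ∷ qs) K =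
    trans (+-cong (signedSubsetSum-*ˡ x B qs (q ℕ.* K)) (-‿cong (signedSubsetSum-*ˡ x B qs K)))
          (sym (x[y-z]≈xy-xz x _ _))

  signedSubsetSum-const : ∀ x q qs K → signedSubsetSum (λ _ → x) (q ∷ qs) K ≈ 0#
  signedSubsetSum-const x q qs K =
    trans (+-congʳ (independent qs (q ℕ.* K) K)) (-‿inverseʳ (signedSubsetSum (λ _ → x) qs K))
    where
    independent : ∀ qs K K′ → signedSubsetSum (λ _ → x) qs K ≈ signedSubsetSum (λ _ → x) qs K′
    independent [] K K′ = refl
    independent (q ∷ qs) K K′ = +-cong (independent qs (q ℕ.* K) (q ℕ.* K′)) (-‿cong (independent qs K K′))

  signedSubsetSum-multiplicative : ∀ (β : ℕ → Carrier) → (∀ q K → Coprime q K → β (q ℕ.* K) ≈ β q * β K) →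
    ∀ qs → AllPairs Coprime qs → ∀ K → All (λ q → Coprime q K) qs →
    signedSubsetSum (λ K → ιℕ K * β K) qs K ≈ ιℕ K * β K * prodR (map (λ q → ιℕ q * β q - 1#) qs)
  signedSubsetSum-multiplicative β β-* [] [] K [] = sym (*-identityʳ _)
  signedSubsetSum-multiplicative β β-* (q ∷ qs) (q⊥qs ∷ qs-coprime) K (q⊥K ∷ qs⊥K) = begin
    signedSubsetSum B qs (q ℕ.* K) - signedSubsetSum B qs K
      ≈⟨ +-cong (signedSubsetSum-multiplicative β β-* qs qs-coprime (q ℕ.* K) (qs⊥qK q⊥qs qs⊥K))
                (-‿cong (signedSubsetSum-multiplicative β β-* qs qs-coprime K qs⊥K)) ⟩
    ιℕ (q ℕ.* K) * β (q ℕ.* K) * Π - ιℕ K * β K * Π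
      ≈⟨ +-congʳ (*-congʳ (*-cong (ιℕ-* q K) (β-* q K q⊥K))) ⟩
    (ιℕ q * ιℕ K) * (β q * β K) * Π - ιℕ K * β K * Π
      ≈⟨ factor (ιℕ q) (ιℕ K) (β q) (β K) Π ⟩
    ιℕ K * β K * ((ιℕ q * β q - 1#) * Π)
      ∎
    where
    B = λ K → ιℕ K * β K
    Π = prodR (map (λ q → ιℕ q * β q - 1#) qs)
    qs⊥qK : ∀ {qs} → All (Coprime q) qs → All (λ q′ → Coprime q′ K) qs → All (λ q′ → Coprime q′ (q ℕ.* K)) qs
    qs⊥qK [] [] = []
    qs⊥qK (q⊥q′ ∷ q⊥qs) (q′⊥K ∷ qs⊥K) = coprime-*ʳ (Coprime.sym q⊥q′) q′⊥K ∷ qs⊥qK q⊥qs qs⊥K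
    factor : ∀ a b x y P → (a * b) * (x * y) * P - b * y * P ≈ b * y * ((a * x - 1#) * P)
    factor = solve 5 (λ a b x y P → (a :* b) :* (x :* y) :* P :- b :* y :* P
                                   := b :* y :* ((a :* x :- con (+ 1)) :* P)) refl

  [∣]-* : ∀ q K m → Coprime q K → [ q ℕ.* K ∣ m ] ≈ [ q ∣ m ] * [ K ∣ m ]
  [∣]-* q K m q⊥K with q ℕ.* K ∣? m | q ∣? m | K ∣? m
  ... | yes _     | yes _   | yes _   = sym (*-identityˡ _)
  ... | yes qK∣m  | no q∤m  | _       = ⊥-elim (q∤m (m*n∣⇒m∣ q K qK∣m))
  ... | yes qK∣m  | yes _   | no K∤m  = ⊥-elim (K∤m (m*n∣⇒n∣ q K qK∣m))
  ... | no qK∤m   | yes q∣m | yes K∣m = ⊥-elim (qK∤m (coprime-*-∣ q⊥K q∣m K∣m))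
  ... | no _      | yes _   | no _    = sym (zeroʳ _)
  ... | no _      | no _    | _       = sym (zeroˡ _)

  prodR-[∣]-sign : ∀ j qs →
    let T = filter (_∣? j) qs in
    prodR (map (λ q → ιℕ q * [ q ∣ j ] - 1#) qs) ≈
      pow (- 1#) (length qs) * (pow (- 1#) (length T) * prodR (map (λ q → ιℕ q - 1#) T))
  prodR-[∣]-sign j [] = solve 0 (con (+ 1) := con (+ 1) :* (con (+ 1) :* con (+ 1))) refl
  prodR-[∣]-sign j (q ∷ qs) with q ∣? j
  ... | yes _ = trans (*-congˡ (prodR-[∣]-sign j qs)) (sign-flips (ιℕ q) _ _ _)
    where
    sign-flips : ∀ a s t P → (a * 1# - 1#) * (s * (t * P)) ≈ (- 1# * s) * ((- 1# * t) * ((a - 1#) * P))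
    sign-flips = solve 4 (λ a s t P → (a :* con (+ 1) :- con (+ 1)) :* (s :* (t :* P))
                                   := (:- con (+ 1) :* s) :* ((:- con (+ 1) :* t) :* ((a :- con (+ 1)) :* P))) refl
  ... | no _ = trans (*-congˡ (prodR-[∣]-sign j qs)) (sign-flip (ιℕ q) _ _ _)
    where
    sign-flip : ∀ a s t P → (a * 0# - 1#) * (s * (t * P)) ≈ (- 1# * s) * (t * P)
    sign-flip = solve 4 (λ a s t P → (a :* con (+ 0) :- con (+ 1)) :* (s :* (t :* P))
                                  := (:- con (+ 1) :* s) :* (t :* P)) refl

module PrimitiveDivisors (A : RegularSystem) where
  open RegularSystem A

  CoprimePrimitives : List ℕ → Set
  CoprimePrimitives qs = AllPairs Coprime qs × All (APrimitive A) qs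

  restrict : ∀ {T qs} → T ⊆ qs → CoprimePrimitives qs → CoprimePrimitives T
  restrict T⊆qs (qs-coprime , qs-primitive) = AllPairs-resp-⊆ T⊆qs qs-coprime , All-resp-⊆ T⊆qs qs-primitive

  primitive-positive : ∀ {qs} → All (APrimitive A) qs → All (1 ≤_) qs
  primitive-positive = All.map (ℕ.<⇒≤ ∘ proj₁)

  product-positive′ : ∀ {qs} → CoprimePrimitives qs → 1 ≤ product qs
  product-positive′ (_ , qs-primitive) = product-positive (primitive-positive qs-primitive)

  ∈A-*-product : ∀ {q qs} → CoprimePrimitives (q ∷ qs) → ∀ d →
    d ∈A (q ℕ.* product qs) ⇔ (∃[ e ] ∃[ f ] (e ∈A q × f ∈A product qs × d ≡ e ℕ.* f))
  ∈A-*-product {q} {qs} (q⊥qs ∷ qs-coprime , q-primitive ∷ qs-primitive) =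
    multiplicative q (product qs) (ℕ.<⇒≤ (proj₁ q-primitive)) (product-positive′ (qs-coprime , qs-primitive))
      (coprime-product q⊥qs)

  ∈A-product⁻ : ∀ {qs} → CoprimePrimitives qs → ∀ d → d ∈A product qs → ∃[ T ] (T ⊆ qs × d ≡ product T)
  ∈A-product⁻ {[]} _ d d∈A1 = [] , [] , Equivalence.to (at-one d) d∈A1
  ∈A-product⁻ {q ∷ qs} good@(_ ∷ qs-coprime , q-primitive ∷ qs-primitive) d d∈A
    with Equivalence.to (∈A-*-product good d) d∈A
  ... | e , f , e∈Aq , f∈A , ≡.refl
    with Equivalence.to (proj₂ q-primitive e) e∈Aq | ∈A-product⁻ (qs-coprime , qs-primitive) f f∈A
  ...   | inj₁ ≡.refl | T , T⊆qs , ≡.refl = T , q ∷ʳ T⊆qs , ℕ.+-identityʳ _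
  ...   | inj₂ ≡.refl | T , T⊆qs , ≡.refl = q ∷ T , ≡.refl ∷ T⊆qs , ≡.refl

  ∈A-product⁺ : ∀ {qs} → CoprimePrimitives qs → ∀ {T} → T ⊆ qs → product T ∈A product qs
  ∈A-product⁺ {[]} _ [] = Equivalence.from (at-one 1) ≡.refl
  ∈A-product⁺ {q ∷ qs} good@(_ ∷ qs-coprime , q-primitive ∷ qs-primitive) {T} (q ∷ʳ T⊆qs) =
    Equivalence.from (∈A-*-product good (product T))
      (1 , product T , Equivalence.from (proj₂ q-primitive 1) (inj₁ ≡.refl) ,
       ∈A-product⁺ (qs-coprime , qs-primitive) T⊆qs , ≡.sym (ℕ.+-identityʳ _))
  ∈A-product⁺ {q ∷ qs} good@(_ ∷ qs-coprime , q-primitive ∷ qs-primitive) {q ∷ T} (≡.refl ∷ T⊆qs) =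
    Equivalence.from (∈A-*-product good (q ℕ.* product T))
      (q , product T , Equivalence.from (proj₂ q-primitive q) (inj₂ ≡.refl) ,
       ∈A-product⁺ (qs-coprime , qs-primitive) T⊆qs , ≡.refl)

  gcdA-product : ∀ {qs} → CoprimePrimitives qs → ∀ j →
    gcdA A j (product qs) ≡ product (filter (_∣? j) qs)
  gcdA-product {qs} good@(qs-coprime , qs-primitive) j =
    foldr-⊔-≡ candidates (All.tabulate bounded) G∈candidates
    where
    n = product qs
    G = product (filter (_∣? j) qs)
    common? = λ d → (d ∣? j) ×-dec (d ∈A? n)
    candidates = filter common? (range1 A n)
    1≤n = product-positive′ good
    1≤G = product-positive (All-resp-⊆ (filter-⊆ (_∣? j) qs) (primitive-positive qs-primitive))
    bounded : ∀ {x} → x ∈ candidates → x ≤ G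
    bounded x∈ with ∈-filter⁻ common? {xs = range1 A n} x∈
    ... | _ , x∣j , x∈A with ∈A-product⁻ good _ x∈A
    ...   | T , T⊆qs , ≡.refl = ∣⇒≤ {{ℕ.>-nonZero 1≤G}} (⊆⇒product-∣ T⊆filter)
      where
      T∣j : All (_∣ j) T
      T∣j = All.map (λ t∣T → ∣-trans t∣T x∣j) (All.tabulate ∈⇒∣product)
      T⊆filter : T ⊆ filter (_∣? j) qs
      T⊆filter = ≡.subst (_⊆ filter (_∣? j) qs) (filter-all (_∣? j) T∣j)
                         (filter⁺ (_∣? j) (_∣? j) (λ { ≡.refl d → d }) T⊆qs)
    G∈candidates : G ∈ candidates
    G∈candidates = ∈-filter⁺ common? G∈range (G∣j , ∈A-product⁺ good (filter-⊆ (_∣? j) qs))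
      where
      G∣j : G ∣ j
      G∣j = product-∣ (AllPairs-resp-⊆ (filter-⊆ (_∣? j) qs) qs-coprime) (all-filter (_∣? j) qs)
      G∈range : G ∈ range1 A n
      G∈range with G | 1≤G | ∣⇒≤ {{ℕ.>-nonZero 1≤n}} (⊆⇒product-∣ (filter-⊆ (_∣? j) qs))
      ... | suc g | _ | G≤n = ∈-applyUpTo⁺ suc G≤n

  gcdA≡1-iff-avoids : ∀ {qs} → CoprimePrimitives qs → ∀ j → does (gcdA A j (product qs) ℕ.≟ 1) ≡ avoids qs j
  gcdA≡1-iff-avoids {qs} good@(_ , qs-primitive) j =
    ≡.trans (≡.cong (λ g → does (g ℕ.≟ 1)) (gcdA-product good j)) (product-filter≡1 qs qs-primitive)
    where
    product-filter≡1 : ∀ qs → All (APrimitive A) qs → does (product (filter (_∣? j) qs) ℕ.≟ 1) ≡ avoids qs j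
    product-filter≡1 [] [] = ≡.refl
    product-filter≡1 (q ∷ qs) (q-primitive ∷ qs-primitive) with q ∣? j
    ... | no _ = product-filter≡1 qs qs-primitive
    ... | yes _ = dec-false (product (q ∷ filter (_∣? j) qs) ℕ.≟ 1) (ℕ.>⇒≢ 1<q*P)
      where
      1≤P = product-positive (All-resp-⊆ (filter-⊆ (_∣? j) qs) (primitive-positive qs-primitive))
      1<q*P : 1 < q ℕ.* product (filter (_∣? j) qs)
      1<q*P = ℕ.<-≤-trans (proj₁ q-primitive) (ℕ.m≤m*n q _ {{ℕ.>-nonZero 1≤P}})

  ∈A-∷-disjoint : ∀ {q qs d} → CoprimePrimitives (q ∷ qs) → d ∈A product qs → ¬ q ∣ d
  ∈A-∷-disjoint (q⊥qs ∷ qs-coprime , q-primitive ∷ qs-primitive) d∈A q∣d =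
    ℕ.<⇒≢ (proj₁ q-primitive) (≡.sym (coprime-product q⊥qs (∣-refl , ∣-trans q∣d d∣P)))
    where
    d∣P = divisor (product-positive′ (qs-coprime , qs-primitive)) d∈A

  module _ {q qs} .{{_ : ℕ.NonZero q}} (good : CoprimePrimitives (q ∷ qs)) where
    private
      good′ = restrict (q ∷ʳ ⊆-refl) good

    ∈A-∷⁻ : ∀ d → d ∈A (q ℕ.* product qs) → d ∈A product qs ⊎ (q ∣ d × (d / q) ∈A product qs)
    ∈A-∷⁻ d d∈A with ∈A-product⁻ good d d∈A
    ... | T , q ∷ʳ T⊆qs , ≡.refl = inj₁ (∈A-product⁺ good′ T⊆qs)
    ... | q ∷ T , ≡.refl ∷ T⊆qs , ≡.refl =
      inj₂ (m∣m*n (product T) , ≡.subst (_∈A product qs) (≡.sym q*P/q≡P) (∈A-product⁺ good′ T⊆qs))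
      where
      q*P/q≡P : q ℕ.* product T / q ≡ product T
      q*P/q≡P = ≡.trans (≡.cong (_/ q) (ℕ.*-comm q (product T))) (m*n/n≡m (product T) q)

    ∈A-∷⁺ˡ : ∀ {d} → d ∈A product qs → d ∈A (q ℕ.* product qs)
    ∈A-∷⁺ˡ {d} d∈A with ∈A-product⁻ good′ d d∈A
    ... | T , T⊆qs , ≡.refl = ∈A-product⁺ good (q ∷ʳ T⊆qs)

    ∈A-∷⁺ʳ : ∀ {d} → q ∣ d → (d / q) ∈A product qs → d ∈A (q ℕ.* product qs)
    ∈A-∷⁺ʳ (divides t ≡.refl) t∈A with ∈A-product⁻ good′ t (≡.subst (_∈A product qs) (m*n/n≡m t q) t∈A)
    ... | T , T⊆qs , ≡.refl =
      ≡.subst (_∈A (q ℕ.* product qs)) (ℕ.*-comm q (product T)) (∈A-product⁺ good (≡.refl ∷ T⊆qs))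

module DivisorSums (A : RegularSystem) {c ℓ : Level} (R : CommutativeRing c ℓ) where
  open RegularSystem A
  open PrimitiveDivisors A
  open CommutativeRing R
  open Poly R
  open Ring R
  open Sieve R

  subsetSum : List ℕ → (List ℕ → Carrier) → Carrier
  subsetSum [] H = H []
  subsetSum (q ∷ qs) H = subsetSum qs H + subsetSum qs (H ∘ (q ∷_))

  subsetSum-neg : ∀ T (H : List ℕ → Carrier) → subsetSum T (λ U → - H U) ≈ - subsetSum T H
  subsetSum-neg [] H = refl
  subsetSum-neg (q ∷ T) H =
    trans (+-cong (subsetSum-neg T H) (subsetSum-neg T (H ∘ (q ∷_)))) (-‿+-comm _ _)

  subsetSum-− : ∀ T (H H′ : List ℕ → Carrier) → subsetSum T (λ U → H U - H′ U) ≈ subsetSum T H - subsetSum T H′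
  subsetSum-− [] H H′ = refl
  subsetSum-− (q ∷ T) H H′ = begin
    subsetSum T (λ U → H U - H′ U) + subsetSum T (λ U → H (q ∷ U) - H′ (q ∷ U))
      ≈⟨ +-cong (subsetSum-− T H H′) (subsetSum-− T (H ∘ (q ∷_)) (H′ ∘ (q ∷_))) ⟩
    (subsetSum T H - subsetSum T H′) + (subsetSum T (H ∘ (q ∷_)) - subsetSum T (H′ ∘ (q ∷_)))
      ≈⟨ regroup _ _ _ _ ⟩
    subsetSum (q ∷ T) H - subsetSum (q ∷ T) H′
      ∎
    where
    regroup : ∀ a b x y → (a - b) + (x - y) ≈ (a + x) - (b + y)
    regroup = solve 4 (λ a b x y → (a :- b) :+ (x :- y) := (a :+ x) :- (b :+ y)) refl

  subsetSum-zero : ∀ T (H : List ℕ → Carrier) → (∀ {U} → U ⊆ T → H U ≈ 0#) → subsetSum T H ≈ 0#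
  subsetSum-zero [] H H≈0 = H≈0 []
  subsetSum-zero (q ∷ T) H H≈0 =
    trans (+-cong (subsetSum-zero T H (H≈0 ∘ (q ∷ʳ_))) (subsetSum-zero T (H ∘ (q ∷_)) (H≈0 ∘ (≡.refl ∷_))))
          (+-identityˡ 0#)

  subsetSum-top : ∀ T (H : List ℕ → Carrier) → (∀ {U} → U ⊆ T → length U < length T → H U ≈ 0#) →
    subsetSum T H ≈ H T
  subsetSum-top [] H _ = refl
  subsetSum-top (q ∷ T) H H≈0 = begin
    subsetSum T H + subsetSum T (H ∘ (q ∷_))
      ≈⟨ +-cong (subsetSum-zero T H (λ U⊆T → H≈0 (q ∷ʳ U⊆T) (ℕ.s≤s (length-mono-≤ U⊆T))))
                (subsetSum-top T (H ∘ (q ∷_)) (λ U⊆T |U|<|T| → H≈0 (≡.refl ∷ U⊆T) (ℕ.s≤s |U|<|T|))) ⟩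
    0# + H (q ∷ T)
      ≈⟨ +-identityˡ _ ⟩
    H (q ∷ T)
      ∎

  ∑₁-A-divisors-beyond : ∀ m N (F : ℕ → Carrier) → 1 ≤ m →
    ∑₁ (m ℕ.+ N) (λ d → when (does (d ∈A? m)) (F d)) ≈ ∑₁ m (λ d → when (does (d ∈A? m)) (F d))
  ∑₁-A-divisors-beyond m N F 1≤m =
    trans (∑-split m N _) (trans (+-congˡ (∑-zero N (λ i _ → not-divisor i))) (+-identityʳ _))
    where
    not-divisor : ∀ i → when (does (suc (m ℕ.+ i) ∈A? m)) (F (suc (m ℕ.+ i))) ≈ 0#
    not-divisor i = when-≡ _ (dec-false (suc (m ℕ.+ i) ∈A? m)
      (λ d∈A → ℕ.<⇒≱ (ℕ.s≤s (ℕ.m≤m+n m i)) (∣⇒≤ {{ℕ.>-nonZero 1≤m}} (divisor 1≤m d∈A))))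

  -- A(q m) is the disjoint union of A(m) and q·A(m).
  when-∈A-∷ : ∀ {q qs} .{{_ : ℕ.NonZero q}} → CoprimePrimitives (q ∷ qs) → ∀ (F : ℕ → Carrier) d →
    let m = product qs in
    when (does (d ∈A? (q ℕ.* m))) (F d) ≈
      when (does (d ∈A? m)) (F d) + when (does (q ∣? d)) (when (does ((d / q) ∈A? m)) (F d))
  when-∈A-∷ {q} {qs} good F d
    with d ∈A? (q ℕ.* product qs) | d ∈A? product qs | q ∣? d | (d / q) ∈A? product qs
  ... | _      | yes d∈A | yes q∣d | _      = ⊥-elim (∈A-∷-disjoint good d∈A q∣d)
  ... | yes _  | yes _   | no _    | _      = sym (+-identityʳ _)
  ... | yes _  | no _    | yes _   | yes _  = sym (+-identityˡ _)
  ... | yes d∈ | no d∉A  | yes _   | no d/q∉A with ∈A-∷⁻ good d d∈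
  ...   | inj₁ d∈A = ⊥-elim (d∉A d∈A)
  ...   | inj₂ (_ , d/q∈A) = ⊥-elim (d/q∉A d/q∈A)
  when-∈A-∷ good F d | yes d∈ | no d∉A | no q∤d | _ with ∈A-∷⁻ good d d∈
  ...   | inj₁ d∈A = ⊥-elim (d∉A d∈A)
  ...   | inj₂ (q∣d , _) = ⊥-elim (q∤d q∣d)
  when-∈A-∷ good F d | no d∉ | yes d∈A | no _ | _ = ⊥-elim (d∉ (∈A-∷⁺ˡ good d∈A))
  when-∈A-∷ good F d | no d∉ | no _ | yes q∣d | yes d/q∈A = ⊥-elim (d∉ (∈A-∷⁺ʳ good q∣d d/q∈A))
  when-∈A-∷ good F d | no _ | no _ | yes _ | no _ = sym (+-identityˡ _)
  when-∈A-∷ good F d | no _ | no _ | no _ | _ = sym (+-identityˡ _)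

  A-divisor-sum : ∀ {qs} → CoprimePrimitives qs → ∀ (F : ℕ → Carrier) →
    ∑₁ (product qs) (λ d → when (does (d ∈A? product qs)) (F d)) ≈ subsetSum qs (F ∘ product)
  A-divisor-sum {[]} _ F with 1 ∈A? 1
  ... | yes _ = +-identityʳ _
  ... | no 1∉A1 = ⊥-elim (1∉A1 (Equivalence.from (at-one 1) ≡.refl))
  A-divisor-sum {zero ∷ qs} (_ , 0-primitive ∷ _) F = ⊥-elim (ℕ.n≮0 (proj₁ 0-primitive))
  A-divisor-sum {suc p ∷ qs} good F = begin
    ∑₁ (q ℕ.* m) (λ d → when (does (d ∈A? (q ℕ.* m))) (F d))
      ≈⟨ ∑-cong (q ℕ.* m) (λ i → when-∈A-∷ good F (suc i)) ⟩
    ∑₁ (q ℕ.* m) (λ d → when (does (d ∈A? m)) (F d) + when (does (q ∣? d)) (G d))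
      ≈⟨ ∑-+ (q ℕ.* m) (λ i → when (does (suc i ∈A? m)) (F (suc i))) (λ i → when (does (q ∣? suc i)) (G (suc i))) ⟩
    ∑₁ (m ℕ.+ p ℕ.* m) (λ d → when (does (d ∈A? m)) (F d)) + ∑₁ (q ℕ.* m) (λ d → when (does (q ∣? d)) (G d))
      ≈⟨ +-cong (∑₁-A-divisors-beyond m (p ℕ.* m) F 1≤m) (∑₁-multiples q m G (ℕ.s≤s ℕ.z≤n)) ⟩
    ∑₁ m (λ d → when (does (d ∈A? m)) (F d)) + ∑₁ m (λ i → G (q ℕ.* i))
      ≈⟨ +-congˡ (∑-cong m (λ i → when-≡ _ (≡.cong (λ x → does (x ∈A? m)) (q*i/q≡i (suc i))))) ⟩
    ∑₁ m (λ d → when (does (d ∈A? m)) (F d)) + ∑₁ m (λ i → when (does (i ∈A? m)) (F (q ℕ.* i)))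
      ≈⟨ +-cong (A-divisor-sum good′ F) (A-divisor-sum good′ (F ∘ (q ℕ.*_))) ⟩
    subsetSum (q ∷ qs) (F ∘ product)
      ∎
    where
    q = suc p
    m = product qs
    good′ = restrict (q ∷ʳ ⊆-refl) good
    1≤m = product-positive′ good′
    G : ℕ → Carrier
    G d = when (does ((d / q) ∈A? m)) (F d)
    q*i/q≡i : ∀ i → q ℕ.* i / q ≡ i
    q*i/q≡i i = ≡.trans (≡.cong (_/ q) (ℕ.*-comm q i)) (m*n/n≡m i q)

  units-sum : ∀ {qs} → CoprimePrimitives qs → ∀ (F : ℕ → Carrier) →
    sumR (map F (unitsA A (product qs))) ≈ sieve qs (product qs) F
  units-sum {qs} good F = begin
    sumR (map F (unitsA A n))
      ≈⟨ sumR-filter (λ j → gcdA A j n ℕ.≟ 1) F (range1 A n) ⟩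
    sumR (map (λ j → when (does (gcdA A j n ℕ.≟ 1)) (F j)) (range1 A n))
      ≈⟨ sumR-range1 A n _ ⟩
    ∑₁ n (λ j → when (does (gcdA A j n ℕ.≟ 1)) (F j))
      ≈⟨ ∑-cong n (λ i → when-≡ (F (suc i)) (gcdA≡1-iff-avoids good (suc i))) ⟩
    sieve qs n F
      ∎
    where n = product qs

module Möbius (A : RegularSystem) (μ : ℕ → ℤ) (isMu : IsMuA A μ) where
  open RegularSystem A
  open PrimitiveDivisors A
  open DivisorSums A ℤ.+-*-commutativeRing
  open Ring ℤ.+-*-commutativeRing using (sumR-filter; sumR-range1; ∑₁; when)
  open Poly ℤ.+-*-commutativeRing using (sumR)
  open ≡.≡-Reasoning

  isOne : ℕ → ℤ
  isOne n = if n ℕ.≡ᵇ 1 then + 1 else + 0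

  isOne->1 : ∀ {n} → 1 < n → isOne n ≡ + 0
  isOne->1 {suc (suc n)} _ = ≡.refl
  isOne->1 {suc zero} (ℕ.s≤s ())

  subsetSum-μ : ∀ {T} → CoprimePrimitives T → subsetSum T (μ ∘ product) ≡ isOne (product T)
  subsetSum-μ {T} good = begin
    subsetSum T (μ ∘ product)                                       ≡⟨ A-divisor-sum good μ ⟨
    ∑₁ m (λ d → when (does (d ∈A? m)) (μ d))                       ≡⟨ sumR-range1 A m _ ⟨
    sumR (map (λ d → when (does (d ∈A? m)) (μ d)) (range1 A m))   ≡⟨ sumR-filter (_∈A? m) μ (range1 A m) ⟨
    sumR (map μ (Adivisors A m))                                    ≡⟨ isMu m (product-positive′ good) ⟩
    isOne m                                                         ∎
    where m = product T

  subsetSum--1^ : ∀ {T} → All (1 <_) T → subsetSum T (-1^_ ∘ length) ≡ isOne (product T)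
  subsetSum--1^ [] = ≡.refl
  subsetSum--1^ {q ∷ T} (1<q ∷ 1<T) = begin
    S ℤ.+ subsetSum T (λ U → ℤ.- (-1^ length U))  ≡⟨ ≡.cong (ℤ._+_ S) (subsetSum-neg T (-1^_ ∘ length)) ⟩
    S ℤ.- S                                      ≡⟨ ℤ.+-inverseʳ S ⟩
    + 0                                          ≡⟨ isOne->1 1<q*P ⟨
    isOne (q ℕ.* product T)                      ∎
    where
    S = subsetSum T (-1^_ ∘ length)
    1<q*P = ℕ.<-≤-trans 1<q (ℕ.m≤m*n q (product T) {{ℕ.>-nonZero (product-positive (All.map ℕ.<⇒≤ 1<T))}})

  -- Over the sublists of any T, both μ ∘ product and -1^_ ∘ length sum to isOne (product T), so ν sums
  -- to 0; by strong induction on |T| every proper sublist contributes 0, leaving ν T = 0.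
  μ-product : ∀ {T} → CoprimePrimitives T → μ (product T) ≡ -1^ length T
  μ-product {T} good = ℤ.i-j≡0⇒i≡j _ _ (<-rec P step (length T) T ≡.refl good)
    where
    ν : List ℕ → ℤ
    ν U = μ (product U) ℤ.- -1^ length U
    P : ℕ → Set
    P k = ∀ T → length T ≡ k → CoprimePrimitives T → ν T ≡ + 0
    step : ∀ k → (∀ {j} → j < k → P j) → P k
    step k rec T ≡.refl good-T = begin
      ν T
        ≡⟨ subsetSum-top T ν (λ U⊆T |U|<|T| → rec |U|<|T| _ ≡.refl (restrict U⊆T good-T)) ⟨
      subsetSum T ν                           ≡⟨ subsetSum-− T (μ ∘ product) (-1^_ ∘ length) ⟩
      subsetSum T (μ ∘ product) ℤ.- subsetSum T (-1^_ ∘ length)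
        ≡⟨ ≡.cong₂ ℤ._-_ (subsetSum-μ good-T) (subsetSum--1^ (All.map proj₁ (proj₂ good-T))) ⟩
      isOne (product T) ℤ.- isOne (product T) ≡⟨ ℤ.+-inverseʳ (isOne (product T)) ⟩
      + 0                                     ∎

module Totient (A : RegularSystem) {c ℓ : Level} (R : CommutativeRing c ℓ) where
  open PrimitiveDivisors A
  open CommutativeRing R
  open Poly R
  open Ring R
  open Sieve R
  open DivisorSums A R

  φA-signedSubsetSum : ∀ {T} → CoprimePrimitives T →
    ιℕ (φA A (product T)) ≈ signedSubsetSum (λ K → ιℕ K * 1#) T 1
  φA-signedSubsetSum {T} good@(T-coprime , T-primitive) = begin
    ιℕ (φA A (product T))                         ≈⟨ ιℕ-length (unitsA A (product T)) ⟩
    sumR (map (λ _ → 1#) (unitsA A (product T)))  ≈⟨ units-sum good (λ _ → 1#) ⟩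
    sieve T (product T) (λ _ → 1#)
      ≈⟨ sieve-product (λ _ → 1#) (λ K → ιℕ K * 1#) T T-coprime (primitive-positive T-primitive)
                       (λ _ K _ → trans (∑₁-1# K) (sym (*-identityʳ _))) ⟩
    signedSubsetSum (λ K → ιℕ K * 1#) T 1         ∎

  φA-product : ∀ {T} → CoprimePrimitives T → ιℕ (φA A (product T)) ≈ prodR (map (λ q → ιℕ q - 1#) T)
  φA-product {T} good@(T-coprime , _) = begin
    ιℕ (φA A (product T))
      ≈⟨ φA-signedSubsetSum good ⟩
    signedSubsetSum (λ K → ιℕ K * 1#) T 1
      ≈⟨ signedSubsetSum-multiplicative (λ _ → 1#) (λ _ _ _ → sym (*-identityˡ 1#)) T T-coprime 1
                                         (All.universal coprime-1 T) ⟩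
    ιℕ 1 * 1# * prodR (map (λ q → ιℕ q * 1# - 1#) T)
      ≈⟨ *-cong (trans (*-identityʳ _) ιℕ-1) (prodR-cong T (λ _ → +-congʳ (*-identityʳ _))) ⟩
    1# * prodR (map (λ q → ιℕ q - 1#) T)
      ≈⟨ *-identityˡ _ ⟩
    prodR (map (λ q → ιℕ q - 1#) T)
      ∎

  ∑₁-gauss : ∀ c K → ∑₁ K (λ u → ιℕ (2 ℕ.* (c ℕ.* u))) ≈ ιℕ c * (ιℕ K * (ιℕ K + 1#))
  ∑₁-gauss c zero = sym (trans (*-congˡ (zeroˡ _)) (zeroʳ _))
  ∑₁-gauss c (suc K) = begin
    ∑ (suc K) (λ i → ιℕ (2 ℕ.* (c ℕ.* suc i)))
      ≈⟨ ∑-last K _ ⟩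
    ∑₁ K (λ u → ιℕ (2 ℕ.* (c ℕ.* u))) + ιℕ (2 ℕ.* (c ℕ.* suc K))
      ≈⟨ +-cong (∑₁-gauss c K) (trans (ιℕ-* 2 (c ℕ.* suc K)) (*-congˡ (ιℕ-* c (suc K)))) ⟩
    ιℕ c * (ιℕ K * (ιℕ K + 1#)) + (1# + (1# + 0#)) * (ιℕ c * (1# + ιℕ K))
      ≈⟨ step (ιℕ c) (ιℕ K) ⟩
    ιℕ c * (ιℕ (suc K) * (ιℕ (suc K) + 1#))
      ∎
    where
    step : ∀ c K → c * (K * (K + 1#)) + (1# + (1# + 0#)) * (c * (1# + K))
                ≈ c * ((1# + K) * ((1# + K) + 1#))
    step = solve 2 (λ c K → c :* (K :* (K :+ con (+ 1))) :+ (con (+ 1) :+ (con (+ 1) :+ con (+ 0))) :* (c :* (con (+ 1) :+ K))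
                          := c :* ((con (+ 1) :+ K) :* ((con (+ 1) :+ K) :+ con (+ 1)))) refl

  -- Classically u ↦ n - u permutes the units; here 2 ∑ u = n φ falls out of inclusion–exclusion.
  units-sum-double : ∀ {q qs} → CoprimePrimitives (q ∷ qs) →
    let n = product (q ∷ qs) in ιℕ (2 ℕ.* sum (unitsA A n)) ≈ ιℕ (n ℕ.* φA A n)
  units-sum-double {q} {qs} good@(coprime , all-primitive) = begin
    ιℕ (2 ℕ.* sum units)
      ≈⟨ trans (ιℕ-* 2 (sum units)) (*-congˡ (ιℕ-sum units)) ⟩
    ιℕ 2 * sumR (map ιℕ units)
      ≈⟨ sumR-*ˡ (ιℕ 2) ιℕ units ⟨
    sumR (map (λ u → ιℕ 2 * ιℕ u) units)
      ≈⟨ sumR-cong units (λ u → sym (ιℕ-* 2 u)) ⟩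
    sumR (map (λ u → ιℕ (2 ℕ.* u)) units)
      ≈⟨ units-sum good (λ u → ιℕ (2 ℕ.* u)) ⟩
    sieve (q ∷ qs) n (λ u → ιℕ (2 ℕ.* u))
      ≈⟨ sieve-product (λ u → ιℕ (2 ℕ.* u)) B (q ∷ qs) coprime (primitive-positive all-primitive) blocks ⟩
    signedSubsetSum B (q ∷ qs) 1
      ≈⟨ signedSubsetSum-*ˡ (ιℕ n) (λ K → ιℕ K * 1# + 1#) (q ∷ qs) 1 ⟩
    ιℕ n * signedSubsetSum (λ K → ιℕ K * 1# + 1#) (q ∷ qs) 1
      ≈⟨ *-congˡ (signedSubsetSum-+ (λ K → ιℕ K * 1#) (λ _ → 1#) (q ∷ qs) 1) ⟩
    ιℕ n * (signedSubsetSum (λ K → ιℕ K * 1#) (q ∷ qs) 1 + signedSubsetSum (λ _ → 1#) (q ∷ qs) 1)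
      ≈⟨ *-congˡ (+-cong (sym (φA-signedSubsetSum good)) (signedSubsetSum-const 1# q qs 1)) ⟩
    ιℕ n * (ιℕ (φA A n) + 0#)
      ≈⟨ *-congˡ (+-identityʳ _) ⟩
    ιℕ n * ιℕ (φA A n)
      ≈⟨ ιℕ-* n (φA A n) ⟨
    ιℕ (n ℕ.* φA A n)
      ∎
    where
    n = product (q ∷ qs)
    units = unitsA A n
    B = λ K → ιℕ n * (ιℕ K * 1# + 1#)
    blocks : ∀ c K → c ℕ.* K ≡ n → ∑₁ K (λ u → ιℕ (2 ℕ.* (c ℕ.* u))) ≈ B K
    blocks c K cK≡n = begin
      ∑₁ K (λ u → ιℕ (2 ℕ.* (c ℕ.* u)))  ≈⟨ ∑₁-gauss c K ⟩
      ιℕ c * (ιℕ K * (ιℕ K + 1#))         ≈⟨ regroup (ιℕ c) (ιℕ K) ⟩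
      ιℕ c * ιℕ K * (ιℕ K * 1# + 1#)      ≈⟨ *-congʳ (trans (sym (ιℕ-* c K)) (reflexive (≡.cong ιℕ cK≡n))) ⟩
      B K                                 ∎
      where
      regroup : ∀ c K → c * (K * (K + 1#)) ≈ c * K * (K * 1# + 1#)
      regroup = solve 2 (λ c K → c :* (K :* (K :+ con (+ 1))) := c :* K :* (K :* con (+ 1) :+ con (+ 1))) refl

module Coefficients (A : RegularSystem) (μ : ℕ → ℤ) (isMu : IsMuA A μ)
  {c ℓ : Level} (R : CommutativeRing c ℓ) (D : Poly.IntegralDomainChar0 R) (ζ : CommutativeRing.Carrier R)
  (q : ℕ) (qs : List ℕ) (good : PrimitiveDivisors.CoprimePrimitives A (q ∷ qs))
  (prim : Poly.PrimitiveRoot R (product (q ∷ qs)) ζ) where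
  open PrimitiveDivisors A
  open CommutativeRing R
  open Poly R
  open Ring R
  open Newton R
  open Roots R
  open Roots.IntegralDomain R D
  open Sieve R
  open DivisorSums A R
  open Totient A R
  open Möbius A μ isMu

  n = product (q ∷ qs)
  units = unitsA A n
  1≤n = product-positive′ good
  a = coeffA A R ζ n

  ζ⁻ : ℕ → Carrier
  ζ⁻ u = pow ζ (u ℕ.* (n ∸ 1))

  ζᵘ*ζ⁻ᵘ≈1 : ∀ u → pow ζ u * ζ⁻ u ≈ 1#
  ζᵘ*ζ⁻ᵘ≈1 u = begin
    pow ζ u * pow ζ (u ℕ.* (n ∸ 1))   ≈⟨ pow-+ ζ u (u ℕ.* (n ∸ 1)) ⟨
    pow ζ (u ℕ.+ u ℕ.* (n ∸ 1))       ≡⟨ ≡.cong (pow ζ) (u+u*[n-1]≡n*u n u 1≤n) ⟩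
    pow ζ (n ℕ.* u)                   ≈⟨ pow-root-of-unity n (proj₁ prim) u ⟩
    1#                                ∎
    where
    u+u*[n-1]≡n*u : ∀ n u → 1 ≤ n → u ℕ.+ u ℕ.* (n ∸ 1) ≡ n ℕ.* u
    u+u*[n-1]≡n*u (suc n) u _ = ≡.cong (u ℕ.+_) (ℕ.*-comm u n)

  ramanujan-sum : ∀ m →
    sumR (map (λ u → pow ζ (u ℕ.* m)) units) ≈ prodR (map (λ q → ιℕ q * [ q ∣ m ] - 1#) (q ∷ qs))
  ramanujan-sum m = begin
    sumR (map (λ u → pow ζ (u ℕ.* m)) units)
      ≈⟨ units-sum good (λ u → pow ζ (u ℕ.* m)) ⟩
    sieve (q ∷ qs) n (λ u → pow ζ (u ℕ.* m))
      ≈⟨ sieve-product (λ u → pow ζ (u ℕ.* m)) (λ K → ιℕ K * [ K ∣ m ]) (q ∷ qs) (proj₁ good)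
           (primitive-positive (proj₂ good)) (∑-roots-of-unity 1≤n prim m) ⟩
    signedSubsetSum (λ K → ιℕ K * [ K ∣ m ]) (q ∷ qs) 1
      ≈⟨ signedSubsetSum-multiplicative [_∣ m ] (λ q K → [∣]-* q K m) (q ∷ qs) (proj₁ good) 1
           (All.universal coprime-1 (q ∷ qs)) ⟩
    ιℕ 1 * [ 1 ∣ m ] * prodR (map (λ q → ιℕ q * [ q ∣ m ] - 1#) (q ∷ qs))
      ≈⟨ *-congʳ (trans (*-cong ιℕ-1 (when-≡ 1# (dec-true (1 ∣? m) (1∣ m)))) (*-identityˡ 1#)) ⟩
    1# * prodR (map (λ q → ιℕ q * [ q ∣ m ] - 1#) (q ∷ qs))
      ≈⟨ *-identityˡ _ ⟩
    prodR (map (λ q → ιℕ q * [ q ∣ m ] - 1#) (q ∷ qs))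
      ∎

  powerSum-ζ⁻ : ∀ j → powerSum ζ⁻ units j ≈ prodR (map (λ q → ιℕ q * [ q ∣ j ] - 1#) (q ∷ qs))
  powerSum-ζ⁻ j = begin
    sumR (map (λ u → pow (ζ⁻ u) j) units)
      ≈⟨ sumR-cong units (λ u → trans (sym (pow-* ζ (u ℕ.* (n ∸ 1)) j))
                                             (reflexive (≡.cong (pow ζ) (ℕ.*-assoc u (n ∸ 1) j)))) ⟩
    sumR (map (λ u → pow ζ (u ℕ.* ((n ∸ 1) ℕ.* j))) units)
      ≈⟨ ramanujan-sum ((n ∸ 1) ℕ.* j) ⟩
    prodR (map (λ q → ιℕ q * [ q ∣ (n ∸ 1) ℕ.* j ] - 1#) (q ∷ qs))
      ≈⟨ prodR-cong (q ∷ qs) (λ q∈ → +-congʳ (*-congˡ (when-≡ 1# (∣?[n-1]*j≡∣?j (∈⇒∣product q∈))))) ⟩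
    prodR (map (λ q → ιℕ q * [ q ∣ j ] - 1#) (q ∷ qs))
      ∎
    where
    ∣?[n-1]*j≡∣?j : ∀ {d} → d ∣ n → does (d ∣? (n ∸ 1) ℕ.* j) ≡ does (d ∣? j)
    ∣?[n-1]*j≡∣?j {d} d∣n = does-⇔ (mk⇔ (coprime-divisor d⊥n-1) (∣n⇒∣m*n (n ∸ 1))) (d ∣? _) (d ∣? j)
      where
      d⊥n-1 : Coprime d (n ∸ 1)
      d⊥n-1 {e} (e∣d , e∣n-1) = ∣1⇒≡1 (∣m+n∣m⇒∣n e∣[n-1]+1 e∣n-1)
        where
        e∣[n-1]+1 : e ∣ (n ∸ 1) ℕ.+ 1
        e∣[n-1]+1 = ≡.subst (e ∣_) (≡.sym (ℕ.m∸n+n≡m 1≤n)) (∣-trans e∣d d∣n)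

  μφ : ℕ → Carrier
  μφ j = ιℤ (μ (gcdA A j n) ℤ.* + φA A (gcdA A j n))

  powerSum-ζ⁻≈μφ : ∀ j → powerSum ζ⁻ units j ≈ ιℤ (μ n) * μφ j
  powerSum-ζ⁻≈μφ j = begin
    powerSum ζ⁻ units j
      ≈⟨ powerSum-ζ⁻ j ⟩
    prodR (map (λ q → ιℕ q * [ q ∣ j ] - 1#) (q ∷ qs))
      ≈⟨ prodR-[∣]-sign j (q ∷ qs) ⟩
    pow (- 1#) (length (q ∷ qs)) * (pow (- 1#) (length T) * prodR (map (λ q → ιℕ q - 1#) T))
      ≈⟨ *-cong (μ≈ good) (*-cong (μ≈ good-T) (φA-product good-T)) ⟨
    ιℤ (μ n) * (ιℤ (μ (product T)) * ιℕ (φA A (product T)))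
      ≈⟨ *-congˡ (ιℤ-* (μ (product T)) (+ φA A (product T))) ⟨
    ιℤ (μ n) * ιℤ (μ (product T) ℤ.* + φA A (product T))
      ≡⟨ ≡.cong (λ g → ιℤ (μ n) * ιℤ (μ g ℤ.* + φA A g)) (gcdA-product good j) ⟨
    ιℤ (μ n) * μφ j
      ∎
    where
    T = filter (_∣? j) (q ∷ qs)
    good-T = restrict (filter-⊆ (_∣? j) (q ∷ qs)) good
    μ≈ : ∀ {U} → CoprimePrimitives U → ιℤ (μ (product U)) ≈ pow (- 1#) (length U)
    μ≈ {U} good-U = trans (reflexive (≡.cong ιℤ (μ-product good-U))) (ιℤ--1^ (length U))

  recurrence : ∀ k → ιℕ k * a k ≈ - (ιℤ (μ n) * sumR (map (λ j → a (k ∸ j) * μφ j) (range1 A k)))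
  recurrence k = begin
    ιℕ k * a k
      ≈⟨ +-inverseˡ-unique _ _ (newton (pow ζ) ζ⁻ units (All.universal ζᵘ*ζ⁻ᵘ≈1 units) k) ⟩
    - conv a (powerSum ζ⁻ units) k
      ≈⟨ -‿cong (∑-cong k (λ i → *-congˡ (powerSum-ζ⁻≈μφ (suc i)))) ⟩
    - ∑₁ k (λ j → a (k ∸ j) * (ιℤ (μ n) * μφ j))
      ≈⟨ -‿cong (∑-cong k (λ i → x*[y*z]≈y*[x*z] (a (k ∸ suc i)) (ιℤ (μ n)) (μφ (suc i)))) ⟩
    - ∑₁ k (λ j → ιℤ (μ n) * (a (k ∸ j) * μφ j))
      ≈⟨ -‿cong (∑-*ˡ k (ιℤ (μ n)) (λ i → a (k ∸ suc i) * μφ (suc i))) ⟩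
    - (ιℤ (μ n) * ∑₁ k (λ j → a (k ∸ j) * μφ j))
      ≈⟨ -‿cong (*-congˡ (sumR-range1 A k (λ j → a (k ∸ j) * μφ j))) ⟨
    - (ιℤ (μ n) * sumR (map (λ j → a (k ∸ j) * μφ j) (range1 A k)))
      ∎
    where
    x*[y*z]≈y*[x*z] : ∀ x y z → x * (y * z) ≈ y * (x * z)
    x*[y*z]≈y*[x*z] = solve 3 (λ x y z → x :* (y :* z) := y :* (x :* z)) refl

  constant-coeff : a 0 ≈ 1#
  constant-coeff = begin
    a 0                                            ≈⟨ coeff-zero-prodLin-pow ζ units ⟩
    pow (- 1#) (length units) * pow ζ (sum units)  ≈⟨ -1^φ*ζ^s≈1 1≤n prim (sum units) (φA A n) 2s≡nφ ⟩
    1#                                             ∎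
    where
    2s≡nφ : 2 ℕ.* sum units ≡ n ℕ.* φA A n
    2s≡nφ = ιℕ-injective _ _ (units-sum-double good)

theorem12 : (A : RegularSystem) (μ : ℕ → ℤ) → IsMuA A μ →
  ∀ {c ℓ : Level} (R : CommutativeRing c ℓ) → Poly.IntegralDomainChar0 R →
  (ζ : CommutativeRing.Carrier R) →
  (n : ℕ) (ps : List (ℕ × ℕ)) → PrimitiveFactorisation A n ps →
  Poly.PrimitiveRoot R n ζ →
  let open CommutativeRing R
      open Poly R
  in (coeffA A R ζ n 0 ≈ 1#) ×
     (∀ k → 1 ≤ k → k ≤ φA A n →
       ιℕ k * coeffA A R ζ n k ≈
         - (ιℤ (μ n) * sumR (map (λ j → coeffA A R ζ n (k ∸ j) *
               ιℤ (μ (gcdA A j n) ℤ.* ℤ.+ (φA A (gcdA A j n))))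
             (range1 A k))))
theorem12 A μ isMu R D ζ n [] (() , _)
-- The recurrence holds for every k.
theorem12 A μ isMu R D ζ n ((p , a) ∷ ps) (_ , primes , distinct , primitives , ≡.refl) prim =
  constant-coeff , λ k _ _ → recurrence k
  where
  open Coefficients A μ isMu R D ζ (p ^ a) (map (λ pa → proj₁ pa ^ proj₂ pa) ps)
         (prime-powers-coprime primes distinct , map⁺ primitives) prim
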